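{- Fix integers $d\geq k>0$. Let $\mathrm{m}$ be a bipartite planar map rooted at a vertex $\rho$, with a marked vertex $\tau\neq\rho$ such that all vertex degrees of $\mathrm{m}$ are at most $d$ and $\deg(\tau)=k$. (i) If $\tau$ is black, then $(\mathrm{m},\tau)$ is a $\mathsf{d}$-trumpet if and only if $\alpha_{d,k}^-$ is feasible on $(\mathrm{m},\tau)$; and in that case every $\alpha_{d,k}^-$-orientation is accessible. (ii) If $\tau$ is white, then $(\mathrm{m},\tau)$ is a $\mathsf{d}$-cornet if and only if $\alpha_{d,k}^+$ is feasible and quasi-accessible on $(\mathrm{m},\tau)$, where quasi-accessible means that for every vertex $v\neq\tau$ there exists a forward path from $v$ to $\rho$.
   Context: Bipartite maps carry a fixed proper black/white coloring. For $d\ge1$, $\alpha_d(v)=d\deg(v)$ if $v$ is black and $\alpha_d(v)=\deg(v)$ if $v$ is white. Define $\alpha_{d,k}^-(v)=\alpha_d(v)-k\mathbf{1}_{\{v=\rho\}}+k\mathbf{1}_{\{v=\tau\}}$ and $\alpha_{d,k}^+(v)=\alpha_d(v)+k\mathbf{1}_{\{v=\rho\}}-k\mathbf{1}_{\{v=\tau\}}$. A $(d+1)$-fractional orientation is a map $\mathcal{O}$ from half-edges to $\mathbb{Z}_{\ge0}$ with $\mathcal{O}(h_1)+\mathcal{O}(h_2)=d+1$ for each edge $\{h_1,h_2\}$; outdegree of $v$ = sum of $\mathcal{O}$ over its half-edges. For a function $\alpha$, an $\alpha$-orientation is a $(d+1)$-fractional orientation with outdegree $\alpha(v)$ at each $v$;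 $\alpha$ is feasible if one exists. A directed edge $(h_1,h_2)$ is forward if $\mathcal{O}(h_1)>0$; accessible = every vertex has a forward path to $\rho$. A cut is a partition $(R,S)$ of the vertices with $\rho\in R$, $\tau\in S$; weight = number of edges between $R$ and $S$. It is black (white) if all vertices of $S$ incident to such edges are black (white); minimal = minimal weight among cuts of that color. The trivial cut is $(V\setminus\{\tau\},\{\tau\})$. $(\mathrm{m},\tau)$ is tight if the trivial cut is minimal among cuts of its color, strictly tight if it is the unique such minimal cut. A $\mathsf{d}$-trumpet is tight with $\tau$ black; a $\mathsf{d}$-cornet is strictly tight with $\tau$ white. -}

module Defs where

open import Data.Nat using (ℕ; zero; suc; _+_; _*_; _≤_; _<_)
open import Data.Integer as ℤ using (ℤ; +_)
open import Data.Fin using (Fin; _≟_)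
import Data.Fin as Fin
open import Data.Bool using (Bool; true; false; if_then_else_; not; _∧_)
open import Data.Product using (Σ; _×_; _,_; ∃)
open import Relation.Nullary using (¬_; Dec; yes; no)
open import Relation.Nullary.Decidable using (⌊_⌋)
open import Relation.Binary.PropositionalEquality using (_≡_; _≢_)
open import Function.Bundles using (_⇔_)

iter : {A : Set} → (A → A) → ℕ → A → A
iter f zero    x = x
iter f (suc n) x = f (iter f n x)

sumFin : (n : ℕ) → (Fin n → ℕ) → ℕ
sumFin zero    f = 0
sumFin (suc n) f = f Fin.zero + sumFin n (λ i → f (Fin.suc i))

-- Edges are Fin nE; half-edges are pairs (e , b); the edge involution
-- ι swaps the two half-edges of an edge.  σ is the rotation permutation
-- around vertices; vertices are the σ-orbits (labelled by Fin nV via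
-- vert), faces are the (σ ∘ ι)-orbits (labelled by Fin nF via face).

HalfEdge : ℕ → Set
HalfEdge nE = Fin nE × Bool

ι : {nE : ℕ} → HalfEdge nE → HalfEdge nE
ι (e , b) = (e , not b)

record Map : Set where
  field
    nE nV nF : ℕ
    σ        : HalfEdge nE → HalfEdge nE
    σ⁻¹      : HalfEdge nE → HalfEdge nE
    σ-inv₁   : ∀ h → σ (σ⁻¹ h) ≡ h
    σ-inv₂   : ∀ h → σ⁻¹ (σ h) ≡ h
    vert     : HalfEdge nE → Fin nV
    vert-surj : ∀ v → ∃ λ h → vert h ≡ v
    vert-orb : ∀ h h' → (vert h ≡ vert h') ⇔ (∃ λ n → iter σ n h ≡ h')
    face     : HalfEdge nE → Fin nF
    face-surj : ∀ f → ∃ λ h → face h ≡ f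
    face-orb : ∀ h h' → (face h ≡ face h') ⇔ (∃ λ n → iter (λ x → σ (ι x)) n h ≡ h')

module _ (m : Map) where
  open Map m

  Vertex : Set
  Vertex = Fin nV

  HE : Set
  HE = HalfEdge nE

  sumHE : (HE → ℕ) → ℕ
  sumHE f = sumFin nE (λ e → f (e , true) + f (e , false))

  data Walk : Vertex → Vertex → Set where
    wnil  : ∀ {v} → Walk v v
    wcons : ∀ {v w} (h : HE) → vert h ≡ v → Walk (vert (ι h)) w → Walk v w

  Connected : Set
  Connected = ∀ u v → Walk u v

  -- planar map: connected, and Euler's formula V - E + F = 2
  Planar : Set
  Planar = Connected × (nV + nF ≡ nE + 2)

  deg : Vertex → ℕ
  deg v = sumHE (λ h → if ⌊ vert h ≟ v ⌋ then 1 else 0)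

data Colour : Set where
  black white : Colour

module _ (m : Map) where
  open Map m

  ProperColouring : (Vertex m → Colour) → Set
  ProperColouring col = ∀ (h : HE m) → col (vert h) ≢ col (vert (ι h))

module _ (m : Map) (col : Vertex m → Colour) (d : ℕ) where
  open Map m

  αd : Vertex m → ℕ
  αd v with col v
  ... | black = d * deg m v
  ... | white = deg m v

  module _ (k : ℕ) (ρ τ : Vertex m) where
    ind : Vertex m → Vertex m → ℤ
    ind x v = if ⌊ v ≟ x ⌋ then + k else + 0

    α⁻ : Vertex m → ℤ
    α⁻ v = ((+ αd v) ℤ.- ind ρ v) ℤ.+ ind τ v

    α⁺ : Vertex m → ℤ
    α⁺ v = ((+ αd v) ℤ.+ ind ρ v) ℤ.- ind τ v

  FracOrientation : (HE m → ℕ) → Set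
  FracOrientation O = ∀ h → O h + O (ι h) ≡ suc d

  outdeg : (HE m → ℕ) → Vertex m → ℕ
  outdeg O v = sumHE m (λ h → if ⌊ vert h ≟ v ⌋ then O h else 0)

  IsOrientation : (Vertex m → ℤ) → (HE m → ℕ) → Set
  IsOrientation α O = FracOrientation O × (∀ v → + outdeg O v ≡ α v)

  Feasible : (Vertex m → ℤ) → Set
  Feasible α = ∃ λ O → IsOrientation α O

  data FPath (O : HE m → ℕ) : Vertex m → Vertex m → Set where
    fnil  : ∀ {v} → FPath O v v
    fcons : ∀ {v w} (h : HE m) → vert h ≡ v → 0 < O h →
            FPath O (vert (ι h)) w → FPath O v w

  Accessible : Vertex m → (HE m → ℕ) → Set
  Accessible ρ O = ∀ v → FPath O v ρ

  QuasiAccessible : Vertex m → Vertex m → (HE m → ℕ) → Set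
  QuasiAccessible ρ τ O = ∀ v → v ≢ τ → FPath O v ρ

module _ (m : Map) (col : Vertex m → Colour) (ρ τ : Vertex m) where
  open Map m

  -- a cut (R , S) is given by the indicator of S
  IsCut : (Vertex m → Bool) → Set
  IsCut S = (S ρ ≡ false) × (S τ ≡ true)

  -- number of edges between R and S (each counted once, via its R-side half-edge)
  weight : (Vertex m → Bool) → ℕ
  weight S = sumHE m (λ h → if not (S (vert h)) ∧ S (vert (ι h)) then 1 else 0)

  CutColour : (Vertex m → Bool) → Colour → Set
  CutColour S c = ∀ h → S (vert h) ≡ false → S (vert (ι h)) ≡ true → col (vert (ι h)) ≡ c

  trivialCut : Vertex m → Bool
  trivialCut v = ⌊ v ≟ τ ⌋

  Tight : Set
  Tight = ∀ S → IsCut S → CutColour S (col τ) → weight trivialCut ≤ weight S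

  StrictlyTight : Set
  StrictlyTight = Tight ×
    (∀ S → IsCut S → CutColour S (col τ) → (∃ λ v → S v ≢ trivialCut v) →
      weight trivialCut < weight S)

  Trumpet : Set
  Trumpet = Tight × (col τ ≡ black)

  Cornet : Set
  Cornet = StrictlyTight × (col τ ≡ white)

-- By Hakimi's theorem, outdegrees a with Σ a = (d+1)|E| are realisable iff (d+1)·e(X) ≤ Σ_{v∈X} a v
-- for every vertex set X, e(X) being the number of edges inside X; it is proved by fixing one edge at a
-- time at the largest value the sets separating its endpoints allow, which stays feasible because e(·)
-- is supermodular.  Since αd v weighs every incident edge by d (v black) or 1 (v white),
-- Σ_{v∈X} αd v − (d+1)·e(X) counts the boundary edges of X at their inside endpoint.  For α∓ with k ≤ d,
-- Hakimi's condition therefore only concerns sets all of whose boundary edges leave through white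
-- vertices, and it says that the corresponding cuts of the colour of τ weigh at least k: tightness.
-- Conversely, an orientation bounds the outdegree of a set S by (d+1)·(e(S) + |∂S|), which gives
-- tightness back.  For accessibility, let S be the set of vertices without a forward path to ρ: no
-- forward edge leaves S, so its outdegree is at most (d+1)·e(S), and for α⁻ this forces ∂S = ∅, hence
-- S = ∅ by connectivity.  For α⁺ the same count permits τ ∈ S and a single black boundary vertex u of
-- S; then d = k and S ∖ {u} is a white cut lighter than deg u ≤ k, while the white case is excluded by
-- strict tightness.

module Submission where

open import Defs
open import Data.Nat using (ℕ; zero; suc; _+_; _*_; _∸_; _≤_; _<_; z≤n; s≤s; _⊓_)
open import Data.Nat.Properties hiding (_≟_; ≟-diag)
import Data.Nat.Tactic.RingSolver as ℕ
import Data.Integer as ℤ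
import Data.Integer.Properties as ℤ
import Data.Integer.Tactic.RingSolver as ℤ
open import Data.Fin using (Fin; _≟_)
import Data.Fin as Fin
import Data.Fin.Properties as Fin
open import Data.Bool using (Bool; true; false; if_then_else_; not; _∧_; _∨_)
import Data.Bool.Properties as Bool
open import Data.Product using (_×_; _,_; ∃; proj₁; proj₂)
open import Data.Sum using (_⊎_; inj₁; inj₂)
open import Data.Empty using (⊥; ⊥-elim)
open import Data.Vec.Functional using (_∷_)
open import Function using (_∘_)
open import Function.Bundles using (_⇔_; mk⇔; Equivalence)
open import Relation.Nullary using (yes; no; ¬_; _×-dec_; _⊎-dec_)
open import Relation.Nullary.Decidable using (⌊_⌋; isYes≗does; dec-true; dec-false; does-⇔; ⌊⌋-map′)
open import Relation.Unary using (Decidable)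
open import Relation.Binary.PropositionalEquality
import Algebra.Properties.Semiring.Sum +-*-semiring as ∑

infix 8 [_]·_
[_]·_ : Bool → ℕ → ℕ
[ b ]· n = if b then n else 0

[]·-distrib-+ : ∀ b m n → [ b ]· (m + n) ≡ [ b ]· m + [ b ]· n
[]·-distrib-+ true  m n = refl
[]·-distrib-+ false m n = refl

[]·-comm : ∀ b c n → [ b ]· [ c ]· n ≡ [ c ]· [ b ]· n
[]·-comm true  c     n = refl
[]·-comm false true  n = refl
[]·-comm false false n = refl

[]·-∨-∧ : ∀ b c n → [ b ]· n + [ c ]· n ≡ [ b ∨ c ]· n + [ b ∧ c ]· n
[]·-∨-∧ true  true  n = refl
[]·-∨-∧ true  false n = refl
[]·-∨-∧ false true  n = sym (+-identityʳ n)
[]·-∨-∧ false false n = refl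

[]·-≤ : ∀ b n → [ b ]· n ≤ n
[]·-≤ true  n = ≤-refl
[]·-≤ false n = z≤n

[]·-mono-∨ : ∀ b c n → [ b ]· n ≤ [ b ∨ c ]· n
[]·-mono-∨ true  c n = ≤-refl
[]·-mono-∨ false c n = z≤n

*-[]·1 : ∀ c b → c * [ b ]· 1 ≡ [ b ]· c
*-[]·1 c true  = *-identityʳ c
*-[]·1 c false = *-zeroʳ c

⌊≟⌋-refl : ∀ {n} (v : Fin n) → ⌊ v ≟ v ⌋ ≡ true
⌊≟⌋-refl v = trans (isYes≗does (v ≟ v)) (dec-true (v ≟ v) refl)

⌊≟⌋-≢ : ∀ {n} {u v : Fin n} → u ≢ v → ⌊ u ≟ v ⌋ ≡ false
⌊≟⌋-≢ {u = u} {v} u≢v = trans (isYes≗does (u ≟ v)) (dec-false (u ≟ v) u≢v)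

⌊≟⌋-sound : ∀ {n} {u v : Fin n} → ⌊ u ≟ v ⌋ ≡ true → u ≡ v
⌊≟⌋-sound {u = u} {v} eq with u ≟ v
... | yes u≡v = u≡v

⌊≟⌋-sym : ∀ {n} (u v : Fin n) → ⌊ u ≟ v ⌋ ≡ ⌊ v ≟ u ⌋
⌊≟⌋-sym u v = trans (isYes≗does (u ≟ v))
  (trans (does-⇔ (mk⇔ sym sym) (u ≟ v) (v ≟ u)) (sym (isYes≗does (v ≟ u))))

sumFin≡∑ : ∀ n (f : Fin n → ℕ) → sumFin n f ≡ ∑.sum f
sumFin≡∑ zero    f = refl
sumFin≡∑ (suc n) f = cong (f Fin.zero +_) (sumFin≡∑ n (f ∘ Fin.suc))

sumFin-cong : ∀ n {f g : Fin n → ℕ} → (∀ i → f i ≡ g i) → sumFin n f ≡ sumFin n g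
sumFin-cong zero    eq = refl
sumFin-cong (suc n) eq = cong₂ _+_ (eq Fin.zero) (sumFin-cong n (eq ∘ Fin.suc))

sumFin-distrib-+ : ∀ n (f g : Fin n → ℕ) →
  sumFin n (λ i → f i + g i) ≡ sumFin n f + sumFin n g
sumFin-distrib-+ n f g = begin
  sumFin n (λ i → f i + g i) ≡⟨ sumFin≡∑ n _ ⟩
  ∑.sum (λ i → f i + g i)    ≡⟨ ∑.∑-distrib-+ f g ⟩
  ∑.sum f + ∑.sum g          ≡⟨ sym (cong₂ _+_ (sumFin≡∑ n f) (sumFin≡∑ n g)) ⟩
  sumFin n f + sumFin n g    ∎
  where open ≡-Reasoning

sumFin-comm : ∀ n m (F : Fin n → Fin m → ℕ) →
  sumFin n (λ i → sumFin m (F i)) ≡ sumFin m (λ j → sumFin n (λ i → F i j))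
sumFin-comm n m F = begin
  sumFin n (λ i → sumFin m (F i))        ≡⟨ sumFin-cong n (λ i → sumFin≡∑ m (F i)) ⟩
  sumFin n (λ i → ∑.sum (F i))           ≡⟨ sumFin≡∑ n _ ⟩
  ∑.sum (λ i → ∑.sum (F i))              ≡⟨ ∑.∑-comm F ⟩
  ∑.sum (λ j → ∑.sum (λ i → F i j))      ≡⟨ sym (sumFin≡∑ m _) ⟩
  sumFin m (λ j → ∑.sum (λ i → F i j))   ≡⟨ sumFin-cong m (λ j → sym (sumFin≡∑ n (λ i → F i j))) ⟩
  sumFin m (λ j → sumFin n (λ i → F i j)) ∎
  where open ≡-Reasoning

*-distribˡ-sumFin : ∀ n c (f : Fin n → ℕ) → c * sumFin n f ≡ sumFin n (λ i → c * f i)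
*-distribˡ-sumFin n c f = begin
  c * sumFin n f             ≡⟨ cong (c *_) (sumFin≡∑ n f) ⟩
  c * ∑.sum f                ≡⟨ ∑.*-distribˡ-sum c f ⟩
  ∑.sum (λ i → c * f i)      ≡⟨ sym (sumFin≡∑ n _) ⟩
  sumFin n (λ i → c * f i)   ∎
  where open ≡-Reasoning

sumFin-[]· : ∀ n b (f : Fin n → ℕ) → sumFin n (λ i → [ b ]· f i) ≡ [ b ]· sumFin n f
sumFin-[]· n true  f = refl
sumFin-[]· n false f = trans (sumFin≡∑ n _) (∑.sum-replicate-zero n)

sumFin-const-1 : ∀ n → sumFin n (λ _ → 1) ≡ n
sumFin-const-1 zero    = refl
sumFin-const-1 (suc n) = cong suc (sumFin-const-1 n)

sumFin-mono-≤ : ∀ n {f g : Fin n → ℕ} → (∀ i → f i ≤ g i) → sumFin n f ≤ sumFin n g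
sumFin-mono-≤ zero    le = z≤n
sumFin-mono-≤ (suc n) le = +-mono-≤ (le Fin.zero) (sumFin-mono-≤ n (le ∘ Fin.suc))

sumFin-mono-≤-at : ∀ n {f g : Fin n → ℕ} k i → (∀ j → f j ≤ g j) → f i + k ≤ g i →
  sumFin n f + k ≤ sumFin n g
sumFin-mono-≤-at (suc n) {f} {g} k Fin.zero le lei = begin
  (f Fin.zero + sumFin n (f ∘ Fin.suc)) + k  ≡⟨ +-comm-middle (f Fin.zero) _ k ⟩
  (f Fin.zero + k) + sumFin n (f ∘ Fin.suc)  ≤⟨ +-mono-≤ lei (sumFin-mono-≤ n (le ∘ Fin.suc)) ⟩
  sumFin (suc n) g                           ∎
  where
  open ≤-Reasoning
  +-comm-middle : ∀ a b c → (a + b) + c ≡ (a + c) + b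
  +-comm-middle = ℕ.solve-∀
sumFin-mono-≤-at (suc n) {f} k (Fin.suc i) le lei =
  ≤-trans (≤-reflexive (+-assoc (f Fin.zero) _ k))
          (+-mono-≤ (le Fin.zero) (sumFin-mono-≤-at n k i (le ∘ Fin.suc) lei))

term≤sumFin : ∀ n (f : Fin n → ℕ) i → f i ≤ sumFin n f
term≤sumFin (suc n) f Fin.zero    = m≤m+n _ _
term≤sumFin (suc n) f (Fin.suc i) = ≤-trans (term≤sumFin n (f ∘ Fin.suc) i) (m≤n+m _ _)

two-terms≤sumFin : ∀ n (f : Fin n → ℕ) i j → i ≢ j → f i + f j ≤ sumFin n f
two-terms≤sumFin (suc n) f Fin.zero    Fin.zero    i≢j = ⊥-elim (i≢j refl)
two-terms≤sumFin (suc n) f Fin.zero    (Fin.suc j) i≢j = +-monoʳ-≤ (f Fin.zero) (term≤sumFin n _ j)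
two-terms≤sumFin (suc n) f (Fin.suc i) Fin.zero    i≢j =
  ≤-trans (≤-reflexive (+-comm (f (Fin.suc i)) _)) (+-monoʳ-≤ (f Fin.zero) (term≤sumFin n _ i))
two-terms≤sumFin (suc n) f (Fin.suc i) (Fin.suc j) i≢j =
  ≤-trans (two-terms≤sumFin n (f ∘ Fin.suc) i j (i≢j ∘ cong Fin.suc)) (m≤n+m _ _)

sumFin-δ : ∀ n (p : Fin n) (f : Fin n → ℕ) → sumFin n (λ v → [ ⌊ p ≟ v ⌋ ]· f v) ≡ f p
sumFin-δ (suc n) Fin.zero    f = trans (cong (f Fin.zero +_) zeros) (+-identityʳ _)
  where
  zeros : sumFin n (λ _ → 0) ≡ 0
  zeros = trans (sumFin≡∑ n _) (∑.sum-replicate-zero n)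
sumFin-δ (suc n) (Fin.suc p) f = trans
  (sumFin-cong n (λ v → cong (λ b → [ b ]· f (Fin.suc v)) (⌊⌋-map′ (cong Fin.suc) Fin.suc-injective (p ≟ v))))
  (sumFin-δ n p (f ∘ Fin.suc))

sumFin-δ′ : ∀ n (p : Fin n) (f : Fin n → ℕ) → sumFin n (λ v → [ ⌊ v ≟ p ⌋ ]· f v) ≡ f p
sumFin-δ′ n p f = trans (sumFin-cong n (λ v → cong (λ b → [ b ]· f v) (⌊≟⌋-sym v p))) (sumFin-δ n p f)

Extensional : ∀ {n} → ((Fin n → Bool) → ℕ) → Set
Extensional g = ∀ {X Y} → X ≗ Y → g X ≡ g Y

minOverSubsets : ∀ n → ((Fin n → Bool) → ℕ) → ℕ
minOverSubsets zero    g = g (λ ())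
minOverSubsets (suc n) g = minOverSubsets n (g ∘ (true ∷_)) ⊓ minOverSubsets n (g ∘ (false ∷_))

minOverSubsets-≤ : ∀ n g → Extensional g → ∀ X → minOverSubsets n g ≤ g X
minOverSubsets-≤ zero    g ext X = ≤-reflexive (ext (λ ()))
minOverSubsets-≤ (suc n) g ext X =
  ≤-trans (⊓-branch (X Fin.zero))
    (≤-trans (minOverSubsets-≤ n _ (ext ∘ ∷-cong) (X ∘ Fin.suc)) (≤-reflexive (ext head∷tail)))
  where
  ⊓-branch : ∀ b → minOverSubsets (suc n) g ≤ minOverSubsets n (g ∘ (b ∷_))
  ⊓-branch true  = m⊓n≤m _ _
  ⊓-branch false = m⊓n≤n _ _
  ∷-cong : ∀ {b A B} → A ≗ B → b ∷ A ≗ b ∷ B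
  ∷-cong A≗B Fin.zero    = refl
  ∷-cong A≗B (Fin.suc i) = A≗B i
  head∷tail : X Fin.zero ∷ (X ∘ Fin.suc) ≗ X
  head∷tail Fin.zero    = refl
  head∷tail (Fin.suc i) = refl

minOverSubsets-attained : ∀ n g → ∃ λ X → minOverSubsets n g ≡ g X
minOverSubsets-attained zero    g = (λ ()) , refl
minOverSubsets-attained (suc n) g
  with minOverSubsets-attained n (g ∘ (true ∷_)) | minOverSubsets-attained n (g ∘ (false ∷_))
... | X₁ , e₁ | X₂ , e₂ with ⊓-sel (minOverSubsets n (g ∘ (true ∷_))) (minOverSubsets n (g ∘ (false ∷_)))
...   | inj₁ e = (true ∷ X₁) , trans e e₁
...   | inj₂ e = (false ∷ X₂) , trans e e₂

slack-transfer : ∀ D {AX AY IX IY} → IX ≤ AX → IY ≤ AY → IX + IY + D ≤ AX + AY →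
  (D ∸ (AX ∸ IX)) + IY ≤ AY
slack-transfer D {AX} {AY} {IX} {IY} IX≤AX IY≤AY le =
  m≤o∸n⇒m+n≤o _ IY≤AY (m≤n+o⇒m∸n≤o D (AX ∸ IX) (+-cancelˡ-≤ (IX + IY) _ _ (begin
    IX + IY + D                                ≤⟨ le ⟩
    AX + AY                                    ≡⟨ sym (cong₂ _+_ (m+[n∸m]≡n IX≤AX) (m+[n∸m]≡n IY≤AY)) ⟩
    (IX + (AX ∸ IX)) + (IY + (AY ∸ IY))        ≡⟨ +-interchange IX (AX ∸ IX) IY (AY ∸ IY) ⟩
    (IX + IY) + ((AX ∸ IX) + (AY ∸ IY))        ∎)))
  where
  open ≤-Reasoning
  +-interchange : ∀ a b c d → (a + b) + (c + d) ≡ (a + c) + (b + d)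
  +-interchange = ℕ.solve-∀

module Hakimi {nV : ℕ} (D : ℕ) where

  infixr 6 _∪_
  infixr 7 _∩_

  _∪_ _∩_ : (Fin nV → Bool) → (Fin nV → Bool) → Fin nV → Bool
  (X ∪ Y) v = X v ∨ Y v
  (X ∩ Y) v = X v ∧ Y v

  ⁅_⁆ : Fin nV → Fin nV → Bool
  ⁅ u ⁆ v = ⌊ v ≟ u ⌋

  sumOver : (Fin nV → Bool) → (Fin nV → ℕ) → ℕ
  sumOver X a = sumFin nV (λ v → [ X v ]· a v)

  inner : ∀ {nE} → (s t : Fin nE → Fin nV) → (Fin nV → Bool) → ℕ
  inner {nE} s t X = sumFin nE (λ e → [ X (s e) ∧ X (t e) ]· D)

  out : ∀ {nE} → (s t : Fin nE → Fin nV) → (Fin nE → ℕ) → Fin nV → ℕ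
  out {nE} s t x v = sumFin nE (λ e → [ ⌊ s e ≟ v ⌋ ]· x e + [ ⌊ t e ≟ v ⌋ ]· (D ∸ x e))

  sumOver-cong : ∀ {X Y} a → X ≗ Y → sumOver X a ≡ sumOver Y a
  sumOver-cong a X≗Y = sumFin-cong nV (λ v → cong (λ b → [ b ]· a v) (X≗Y v))

  sumOver-distrib-+ : ∀ X a b → sumOver X (λ v → a v + b v) ≡ sumOver X a + sumOver X b
  sumOver-distrib-+ X a b = trans (sumFin-cong nV (λ v → []·-distrib-+ (X v) (a v) (b v))) (sumFin-distrib-+ nV _ _)

  sumOver-∪-∩ : ∀ X Y a → sumOver X a + sumOver Y a ≡ sumOver (X ∪ Y) a + sumOver (X ∩ Y) a
  sumOver-∪-∩ X Y a = trans (sym (sumFin-distrib-+ nV _ _))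
    (trans (sumFin-cong nV (λ v → []·-∨-∧ (X v) (Y v) (a v))) (sumFin-distrib-+ nV _ _))

  sumOver-⁅⁆ : ∀ u a → sumOver ⁅ u ⁆ a ≡ a u
  sumOver-⁅⁆ u a = sumFin-δ′ nV u a

  inner-cong : ∀ {nE} (s t : Fin nE → Fin nV) {X Y} → X ≗ Y → inner s t X ≡ inner s t Y
  inner-cong {nE} s t X≗Y = sumFin-cong nE (λ e → cong₂ (λ b c → [ b ∧ c ]· D) (X≗Y (s e)) (X≗Y (t e)))

  edge-supermodular : ∀ xs xt ys yt →
    [ xs ∧ xt ]· D + [ ys ∧ yt ]· D ≤ [ (xs ∨ ys) ∧ (xt ∨ yt) ]· D + [ (xs ∧ ys) ∧ (xt ∧ yt) ]· D
  edge-supermodular true  true  ys    yt    = ≤-refl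
  edge-supermodular true  false true  true  = m≤m+n D _
  edge-supermodular false true  true  true  = m≤m+n D _
  edge-supermodular false false true  true  = m≤m+n D _
  edge-supermodular true  false true  false = z≤n
  edge-supermodular true  false false yt    = z≤n
  edge-supermodular false xt    true  false = z≤n
  edge-supermodular false xt    false yt    = z≤n

  -- An edge from X ∖ Y to Y ∖ X lies inside X ∪ Y only.
  inner-supermodular-at : ∀ {nE} (s t : Fin nE → Fin nV) X Y e →
    X (s e) ≡ true → X (t e) ≡ false → Y (s e) ≡ false → Y (t e) ≡ true →
    inner s t X + inner s t Y + D ≤ inner s t (X ∪ Y) + inner s t (X ∩ Y)
  inner-supermodular-at {nE} s t X Y e₀ xs xt ys yt = begin
    inner s t X + inner s t Y + D                         ≡⟨ cong (_+ D) (sym (sumFin-distrib-+ nE _ _)) ⟩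
    sumFin nE (λ e → edge X e + edge Y e) + D             ≤⟨ sumFin-mono-≤-at nE D e₀ per-edge crossing ⟩
    sumFin nE (λ e → edge (X ∪ Y) e + edge (X ∩ Y) e)     ≡⟨ sumFin-distrib-+ nE _ _ ⟩
    inner s t (X ∪ Y) + inner s t (X ∩ Y)                 ∎
    where
    open ≤-Reasoning
    edge : (Fin nV → Bool) → Fin nE → ℕ
    edge Z e = [ Z (s e) ∧ Z (t e) ]· D
    per-edge : ∀ e → edge X e + edge Y e ≤ edge (X ∪ Y) e + edge (X ∩ Y) e
    per-edge e = edge-supermodular (X (s e)) (X (t e)) (Y (s e)) (Y (t e))
    crossing : edge X e₀ + edge Y e₀ + D ≤ edge (X ∪ Y) e₀ + edge (X ∩ Y) e₀
    crossing rewrite xs | xt | ys | yt = m≤m+n D 0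

  module FirstEdge {n} (s t : Fin (suc n) → Fin nV) (a : Fin nV → ℕ)
                   (inner≤ : ∀ X → inner s t X ≤ sumOver X a) (p≢q : s Fin.zero ≢ t Fin.zero) where

    p q : Fin nV
    p = s Fin.zero
    q = t Fin.zero

    s′ t′ : Fin n → Fin nV
    s′ = s ∘ Fin.suc
    t′ = t ∘ Fin.suc

    slack : (Fin nV → Bool) → ℕ
    slack X = sumOver X a ∸ inner s t X

    -- Only the sets containing p but not q constrain the value y on the first edge p → q.
    capacity : (Fin nV → Bool) → ℕ
    capacity X = if X p ∧ not (X q) then slack X else D

    y : ℕ
    y = minOverSubsets nV capacity

    capacity-ext : Extensional capacity
    capacity-ext X≗Y = cong₂ (λ b c → if b then c else D)
      (cong₂ (λ b c → b ∧ not c) (X≗Y p) (X≗Y q)) (cong₂ _∸_ (sumOver-cong a X≗Y) (inner-cong s t X≗Y))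

    capacity-cases : ∀ X → (X p ≡ true × X q ≡ false × capacity X ≡ slack X) ⊎ capacity X ≡ D
    capacity-cases X with X p | X q
    ... | true  | false = inj₁ (refl , refl , refl)
    ... | true  | true  = inj₂ refl
    ... | false | _     = inj₂ refl

    y≤D : y ≤ D
    y≤D = minOverSubsets-≤ nV capacity capacity-ext (λ _ → false)

    y-fits-out : ∀ X → X p ≡ true → X q ≡ false → y + inner s t X ≤ sumOver X a
    y-fits-out X xp xq = m≤o∸n⇒m+n≤o y (inner≤ X) (begin
      y          ≤⟨ minOverSubsets-≤ nV capacity capacity-ext X ⟩
      capacity X ≡⟨ cong₂ (λ b c → if b ∧ not c then slack X else D) xp xq ⟩
      slack X    ∎)
      where open ≤-Reasoning

    -- The minimiser X of the capacity and a set Y ∋ q ∌ p interact through supermodularity of inner.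
    y-fits-in : ∀ Y → Y p ≡ false → Y q ≡ true → (D ∸ y) + inner s t Y ≤ sumOver Y a
    y-fits-in Y yp yq with minOverSubsets-attained nV capacity
    ... | X , y≡cap with capacity-cases X
    ...   | inj₂ cap≡D = ≤-trans (≤-reflexive (cong (_+ inner s t Y) D∸y≡0)) (inner≤ Y)
      where
      D∸y≡0 : D ∸ y ≡ 0
      D∸y≡0 = trans (cong (D ∸_) (trans y≡cap cap≡D)) (n∸n≡0 D)
    ...   | inj₁ (xp , xq , cap≡slack) =
      subst (λ z → (D ∸ z) + inner s t Y ≤ sumOver Y a) (sym (trans y≡cap cap≡slack))
        (slack-transfer D (inner≤ X) (inner≤ Y) (begin
          inner s t X + inner s t Y + D                 ≤⟨ inner-supermodular-at s t X Y Fin.zero xp xq yp yq ⟩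
          inner s t (X ∪ Y) + inner s t (X ∩ Y)         ≤⟨ +-mono-≤ (inner≤ (X ∪ Y)) (inner≤ (X ∩ Y)) ⟩
          sumOver (X ∪ Y) a + sumOver (X ∩ Y) a         ≡⟨ sym (sumOver-∪-∩ X Y a) ⟩
          sumOver X a + sumOver Y a                     ∎))
      where open ≤-Reasoning

    y+[D∸y] : y + (D ∸ y) ≡ D
    y+[D∸y] = m+[n∸m]≡n y≤D

    share : Fin nV → ℕ
    share v = [ ⌊ p ≟ v ⌋ ]· y + [ ⌊ q ≟ v ⌋ ]· (D ∸ y)

    share≤a : ∀ v → share v ≤ a v
    share≤a v with p ≟ v | q ≟ v
    ... | yes refl | yes q≡p = ⊥-elim (p≢q (sym q≡p))
    ... | yes refl | no  _   = ≤-trans (≤-reflexive (+-identityʳ y))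
          (m+n≤o⇒m≤o y (≤-trans (y-fits-out ⁅ p ⁆ (⌊≟⌋-refl p) (⌊≟⌋-≢ (p≢q ∘ sym))) (≤-reflexive (sumOver-⁅⁆ p a))))
    ... | no  _    | yes refl = m+n≤o⇒m≤o (D ∸ y)
          (≤-trans (y-fits-in ⁅ q ⁆ (⌊≟⌋-≢ p≢q) (⌊≟⌋-refl q)) (≤-reflexive (sumOver-⁅⁆ q a)))
    ... | no  _    | no  _    = z≤n

    residual : Fin nV → ℕ
    residual v = a v ∸ share v

    sumOver-a : ∀ X → sumOver X a ≡ sumOver X residual + ([ X p ]· y + [ X q ]· (D ∸ y))
    sumOver-a X = begin
      sumOver X a                                   ≡⟨ sumOver-cong′ (λ v → sym (m∸n+n≡m (share≤a v))) ⟩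
      sumOver X (λ v → residual v + share v)        ≡⟨ sumOver-distrib-+ X residual share ⟩
      sumOver X residual + sumOver X share          ≡⟨ cong (sumOver X residual +_) sumOver-share ⟩
      sumOver X residual + ([ X p ]· y + [ X q ]· (D ∸ y)) ∎
      where
      open ≡-Reasoning
      sumOver-cong′ : ∀ {b c} → b ≗ c → sumOver X b ≡ sumOver X c
      sumOver-cong′ b≗c = sumFin-cong nV (λ v → cong ([ X v ]·_) (b≗c v))
      δ-at : ∀ u m → sumOver X (λ v → [ ⌊ u ≟ v ⌋ ]· m) ≡ [ X u ]· m
      δ-at u m = trans (sumFin-cong nV (λ v → []·-comm (X v) _ m)) (sumFin-δ nV u (λ v → [ X v ]· m))
      sumOver-share : sumOver X share ≡ [ X p ]· y + [ X q ]· (D ∸ y)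
      sumOver-share = trans (sumOver-distrib-+ X _ _) (cong₂ _+_ (δ-at p y) (δ-at q (D ∸ y)))

    residual-condition : ∀ X → inner s′ t′ X ≤ sumOver X residual
    residual-condition X = cancel (X p) (X q) (subst (inner s t X ≤_) (sumOver-a X) (inner≤ X))
      (λ xp xq → subst (y + inner s t X ≤_) (sumOver-a X) (y-fits-out X xp xq))
      (λ xp xq → subst ((D ∸ y) + inner s t X ≤_) (sumOver-a X) (y-fits-in X xp xq))
      where
      cancel : ∀ bp bq {I R} → [ bp ∧ bq ]· D + I ≤ R + ([ bp ]· y + [ bq ]· (D ∸ y)) →
        (bp ≡ true → bq ≡ false → y + ([ bp ∧ bq ]· D + I) ≤ R + ([ bp ]· y + [ bq ]· (D ∸ y))) →
        (bp ≡ false → bq ≡ true → (D ∸ y) + ([ bp ∧ bq ]· D + I) ≤ R + ([ bp ]· y + [ bq ]· (D ∸ y))) →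
        I ≤ R
      cancel true  true  {I} {R} both _ _ = +-cancelˡ-≤ D I R
        (≤-trans both (≤-reflexive (trans (cong (R +_) y+[D∸y]) (+-comm R D))))
      cancel true  false {I} {R} _ out _ = +-cancelˡ-≤ y I R
        (≤-trans (out refl refl) (≤-reflexive (trans (cong (R +_) (+-identityʳ y)) (+-comm R y))))
      cancel false true  {I} {R} _ _ in′ = +-cancelˡ-≤ (D ∸ y) I R
        (≤-trans (in′ refl refl) (≤-reflexive (+-comm R _)))
      cancel false false {I} {R} none _ _ = ≤-trans none (≤-reflexive (+-identityʳ R))

    residual-total : sumFin (suc n) (λ _ → D) ≡ sumFin nV a → sumFin n (λ _ → D) ≡ sumFin nV residual
    residual-total total = +-cancelˡ-≡ D _ _ (begin
      D + sumFin n (λ _ → D)          ≡⟨ total ⟩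
      sumFin nV a                     ≡⟨ sumOver-a (λ _ → true) ⟩
      sumFin nV residual + (y + (D ∸ y)) ≡⟨ cong (sumFin nV residual +_) y+[D∸y] ⟩
      sumFin nV residual + D          ≡⟨ +-comm _ D ⟩
      D + sumFin nV residual          ∎)
      where open ≡-Reasoning

  hakimi : ∀ nE (s t : Fin nE → Fin nV) → (∀ e → s e ≢ t e) → (a : Fin nV → ℕ) →
    (∀ X → inner s t X ≤ sumOver X a) → sumFin nE (λ _ → D) ≡ sumFin nV a →
    ∃ λ x → (∀ e → x e ≤ D) × (∀ v → out s t x v ≡ a v)
  hakimi zero s t loopless a inner≤ total =
    (λ ()) , (λ ()) , λ v → sym (n≤0⇒n≡0 (≤-trans (term≤sumFin nV a v) (≤-reflexive (sym total))))
  hakimi (suc n) s t loopless a inner≤ total = x , x≤D , out≡a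
    where
    open FirstEdge s t a inner≤ (loopless Fin.zero)
    rest : ∃ λ x′ → (∀ e → x′ e ≤ D) × (∀ v → out s′ t′ x′ v ≡ residual v)
    rest = hakimi n s′ t′ (loopless ∘ Fin.suc) residual residual-condition (residual-total total)
    x : Fin (suc n) → ℕ
    x Fin.zero    = y
    x (Fin.suc e) = proj₁ rest e
    x≤D : ∀ e → x e ≤ D
    x≤D Fin.zero    = y≤D
    x≤D (Fin.suc e) = proj₁ (proj₂ rest) e
    out≡a : ∀ v → out s t x v ≡ a v
    out≡a v = trans (cong (share v +_) (proj₂ (proj₂ rest) v)) (trans (+-comm (share v) _) (m∸n+n≡m (share≤a v)))

colourWeight : ℕ → Colour → ℕ
colourWeight d black = d
colourWeight d white = 1

colourWeight-+ : ∀ d {c c′} → c ≢ c′ → colourWeight d c + colourWeight d c′ ≡ suc d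
colourWeight-+ d {black} {black} c≢c′ = ⊥-elim (c≢c′ refl)
colourWeight-+ d {black} {white} c≢c′ = +-comm d 1
colourWeight-+ d {white} {black} c≢c′ = refl
colourWeight-+ d {white} {white} c≢c′ = ⊥-elim (c≢c′ refl)

colourWeight-≥1 : ∀ {d} → 1 ≤ d → ∀ c → 1 ≤ colourWeight d c
colourWeight-≥1 1≤d black = 1≤d
colourWeight-≥1 1≤d white = ≤-refl

crossing : Bool → Bool → ℕ
crossing xs xt = [ not xs ∧ xt ]· 1 + [ not xt ∧ xs ]· 1

isBlack : Colour → Bool
isBlack black = true
isBlack white = false

blackExit : Bool → Bool → Colour → Colour → Bool
blackExit xs xt cs ct = (xs ∧ not xt ∧ isBlack cs) ∨ (xt ∧ not xs ∧ isBlack ct)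

blackExit⇒1≤crossing : ∀ xs xt cs ct → blackExit xs xt cs ct ≡ true → 1 ≤ crossing xs xt
blackExit⇒1≤crossing true  false black ct    _ = ≤-refl
blackExit⇒1≤crossing false true  cs    black _ = ≤-refl
blackExit⇒1≤crossing true  true  cs    ct    ()
blackExit⇒1≤crossing true  false white ct    ()
blackExit⇒1≤crossing false true  cs    white ()
blackExit⇒1≤crossing false false cs    ct    ()

ExitsColoured : Colour → Bool → Bool → Colour → Colour → Set
ExitsColoured c xs xt cs ct = (xs ≡ true → xt ≡ false → cs ≡ c) × (xt ≡ true → xs ≡ false → ct ≡ c)

opposite : Colour → Colour
opposite black = white
opposite white = black

≢⇒opposite : ∀ {c c′} → c ≢ c′ → c′ ≡ opposite c
≢⇒opposite {black} {black} c≢c′ = ⊥-elim (c≢c′ refl)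
≢⇒opposite {black} {white} c≢c′ = refl
≢⇒opposite {white} {black} c≢c′ = refl
≢⇒opposite {white} {white} c≢c′ = ⊥-elim (c≢c′ refl)

exitsColoured-white : ∀ xs xt cs ct → blackExit xs xt cs ct ≡ false → ExitsColoured white xs xt cs ct
exitsColoured-white true  false white ct    _ = (λ _ _ → refl) , (λ ())
exitsColoured-white false true  cs    white _ = (λ ()) , (λ _ _ → refl)
exitsColoured-white true  true  cs    ct    _ = (λ _ ()) , (λ _ ())
exitsColoured-white false false cs    ct    _ = (λ ()) , (λ ())
exitsColoured-white true  false black ct    ()
exitsColoured-white false true  cs    black ()

crossing-removed : ∀ xs xt us ut → crossing xs xt ≡ 0 → crossing (xs ∧ not us) (xt ∧ not ut) ≤ [ us ]· 1 + [ ut ]· 1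
crossing-removed true  true  true  true  _ = z≤n
crossing-removed true  true  true  false _ = ≤-refl
crossing-removed true  true  false true  _ = ≤-refl
crossing-removed true  true  false false _ = z≤n
crossing-removed false false us    ut    _ = z≤n
crossing-removed true  false us    ut    ()
crossing-removed false true  us    ut    ()

module EdgeAccounting (d : ℕ) where

  D : ℕ
  D = suc d

  gain : Bool → Bool → Colour → Colour → ℕ
  gain xs xt cs ct = [ xs ]· colourWeight d cs + [ xt ]· colourWeight d ct

  gain-≥ : 1 ≤ d → ∀ xs xt {cs ct} → cs ≢ ct → [ xs ∧ xt ]· D + crossing xs xt ≤ gain xs xt cs ct
  gain-≥ 1≤d true  true  cs≢ct = ≤-reflexive (trans (+-identityʳ D) (sym (colourWeight-+ d cs≢ct)))
  gain-≥ 1≤d true  false {cs} cs≢ct = ≤-trans (colourWeight-≥1 1≤d cs) (m≤m+n _ 0)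
  gain-≥ 1≤d false true  {ct = ct} cs≢ct = colourWeight-≥1 1≤d ct
  gain-≥ 1≤d false false cs≢ct = z≤n

  gain-≥-blackExit : 1 ≤ d → ∀ xs xt cs ct → blackExit xs xt cs ct ≡ true →
    ([ xs ∧ xt ]· D + crossing xs xt) + (d ∸ 1) ≤ gain xs xt cs ct
  gain-≥-blackExit 1≤d true  false black ct    _ = ≤-reflexive (trans (m+[n∸m]≡n 1≤d) (sym (+-identityʳ d)))
  gain-≥-blackExit 1≤d false true  cs    black _ = ≤-reflexive (m+[n∸m]≡n 1≤d)
  gain-≥-blackExit 1≤d true  true  cs    ct    ()
  gain-≥-blackExit 1≤d true  false white ct    ()
  gain-≥-blackExit 1≤d false true  cs    white ()
  gain-≥-blackExit 1≤d false false cs    ct    ()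

  gain-≤-whiteExits : ∀ xs xt {cs ct} → cs ≢ ct → ExitsColoured white xs xt cs ct →
    gain xs xt cs ct ≤ [ xs ∧ xt ]· D + crossing xs xt
  gain-≤-whiteExits true  true  cs≢ct _  = ≤-reflexive (trans (colourWeight-+ d cs≢ct) (sym (+-identityʳ D)))
  gain-≤-whiteExits true  false cs≢ct ex rewrite proj₁ ex refl refl = ≤-refl
  gain-≤-whiteExits false true  cs≢ct ex rewrite proj₂ ex refl refl = ≤-refl
  gain-≤-whiteExits false false cs≢ct _  = z≤n

  gain-≥-blackExits : ∀ xs xt {cs ct} → cs ≢ ct → ExitsColoured black xs xt cs ct →
    [ xs ∧ xt ]· D + d * crossing xs xt ≤ gain xs xt cs ct
  gain-≥-blackExits true  true  cs≢ct _ =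
    ≤-reflexive (trans (cong (D +_) (*-zeroʳ d)) (trans (+-identityʳ D) (sym (colourWeight-+ d cs≢ct))))
  gain-≥-blackExits true  false cs≢ct ex rewrite proj₁ ex refl refl =
    ≤-reflexive (trans (*-identityʳ d) (sym (+-identityʳ d)))
  gain-≥-blackExits false true  cs≢ct ex rewrite proj₂ ex refl refl = ≤-reflexive (*-identityʳ d)
  gain-≥-blackExits false false cs≢ct _ = ≤-reflexive (*-zeroʳ d)

  edgeOut : Bool → Bool → ℕ → ℕ → ℕ
  edgeOut xs xt o₁ o₂ = [ xs ]· o₁ + [ xt ]· o₂

  edgeOut-≤ : ∀ xs xt {o₁ o₂} → o₁ + o₂ ≡ D → edgeOut xs xt o₁ o₂ ≤ [ xs ∧ xt ]· D + D * crossing xs xt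
  edgeOut-≤ true  true  o≡D = ≤-reflexive (trans o≡D (sym (trans (cong (D +_) (*-zeroʳ D)) (+-identityʳ D))))
  edgeOut-≤ true  false {o₁} o≡D =
    ≤-trans (≤-reflexive (+-identityʳ o₁)) (≤-trans (m+n≤o⇒m≤o o₁ (≤-reflexive o≡D)) (≤-reflexive (sym (*-identityʳ D))))
  edgeOut-≤ false true  {o₁} o≡D = ≤-trans (m+n≤o⇒n≤o o₁ (≤-reflexive o≡D)) (≤-reflexive (sym (*-identityʳ D)))
  edgeOut-≤ false false o≡D = z≤n

  edgeOut-≥ : ∀ xs xt {o₁ o₂} → o₁ + o₂ ≡ D → [ xs ∧ xt ]· D ≤ edgeOut xs xt o₁ o₂
  edgeOut-≥ true  true  o≡D = ≤-reflexive (sym o≡D)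
  edgeOut-≥ true  false o≡D = z≤n
  edgeOut-≥ false xt    o≡D = z≤n

  edgeOut-≥-exit₁ : ∀ {o₁} o₂ → 0 < o₁ → [ true ∧ false ]· D + 1 ≤ edgeOut true false o₁ o₂
  edgeOut-≥-exit₁ {o₁} o₂ 0<o₁ = ≤-trans 0<o₁ (≤-reflexive (sym (+-identityʳ o₁)))

  edgeOut-≥-exit₂ : ∀ o₁ {o₂} → 0 < o₂ → [ false ∧ true ]· D + 1 ≤ edgeOut false true o₁ o₂
  edgeOut-≥-exit₂ o₁ 0<o₂ = 0<o₂

  edgeOut-≤-noExit : ∀ xs xt {o₁ o₂} → o₁ + o₂ ≡ D →
    (xs ≡ true → xt ≡ false → o₁ ≡ 0) → (xt ≡ true → xs ≡ false → o₂ ≡ 0) →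
    edgeOut xs xt o₁ o₂ ≤ [ xs ∧ xt ]· D
  edgeOut-≤-noExit true  true  o≡D _ _ = ≤-reflexive o≡D
  edgeOut-≤-noExit true  false o≡D o₁≡0 _ rewrite o₁≡0 refl refl = z≤n
  edgeOut-≤-noExit false true  o≡D _ o₂≡0 rewrite o₂≡0 refl refl = z≤n
  edgeOut-≤-noExit false false o≡D _ _ = z≤n

module MapAccounting (m : Map) (col : Vertex m → Colour) (d : ℕ) where
  open Map m
  open EdgeAccounting d public
  open Hakimi {nV} D public

  s t : Fin nE → Fin nV
  s e = vert (e , true)
  t e = vert (e , false)

  -- Definitionally the weight of the cut with S = X.
  boundary : (Fin nV → Bool) → ℕ
  boundary X = sumFin nE (λ e → crossing (X (s e)) (X (t e)))

  BoundaryColour : (Fin nV → Bool) → Colour → Set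
  BoundaryColour X c = ∀ h → X (vert h) ≡ false → X (vert (ι h)) ≡ true → col (vert (ι h)) ≡ c

  blackExits : (Fin nV → Bool) → Fin nE → Bool
  blackExits X e = blackExit (X (s e)) (X (t e)) (col (s e)) (col (t e))

  exitsColoured : ∀ {X c} → BoundaryColour X c → ∀ e → ExitsColoured c (X (s e)) (X (t e)) (col (s e)) (col (t e))
  exitsColoured bc e = (λ xs xt → bc (e , false) xt xs) , (λ xt xs → bc (e , true) xs xt)

  boundary-complement : ∀ X → boundary (not ∘ X) ≡ boundary X
  boundary-complement X = sumFin-cong nE (λ e → per-edge (X (s e)) (X (t e)))
    where
    per-edge : ∀ a b → crossing (not a) (not b) ≡ crossing a b
    per-edge true  true  = refl
    per-edge true  false = refl
    per-edge false true  = refl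
    per-edge false false = refl

  whiteBoundary : ∀ X → (∀ e → blackExits X e ≡ false) → BoundaryColour X white
  whiteBoundary X no-black (e , true)  xs xt = proj₂ (exitsColoured-white _ _ _ _ (no-black e)) xt xs
  whiteBoundary X no-black (e , false) xt xs = proj₁ (exitsColoured-white _ _ _ _ (no-black e)) xs xt

  complement-blackBoundary : ProperColouring m col → ∀ X → BoundaryColour X white → BoundaryColour (not ∘ X) black
  complement-blackBoundary proper X white-exits (e , true)  xs xt =
    trans (≢⇒opposite (proper (e , true))) (cong opposite (white-exits (e , false) (Bool.not-injective xt) (Bool.not-injective xs)))
  complement-blackBoundary proper X white-exits (e , false) xt xs =
    trans (≢⇒opposite (proper (e , false))) (cong opposite (white-exits (e , true) (Bool.not-injective xs) (Bool.not-injective xt)))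

  blackExit-halfEdge : ∀ X e → blackExits X e ≡ true →
    ∃ λ b → X (vert (e , b)) ≡ true × X (vert (ι (e , b))) ≡ false × col (vert (e , b)) ≡ black
  blackExit-halfEdge X e black-exit with X (s e) in xs | X (t e) in xt | col (s e) in cs | col (t e) in ct
  ... | true  | false | black | _     = true , xs , xt , cs
  ... | false | true  | _     | black = false , xt , xs , ct

  -- Each vertex v counts its incident half-edges; summing over v ∈ X instead counts, per edge, its endpoints in X.
  sumOver-incidence : ∀ X (A B : Fin nE → Fin nV → ℕ) →
    sumOver X (λ v → sumFin nE (λ e → [ ⌊ s e ≟ v ⌋ ]· A e v + [ ⌊ t e ≟ v ⌋ ]· B e v)) ≡
    sumFin nE (λ e → [ X (s e) ]· A e (s e) + [ X (t e) ]· B e (t e))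
  sumOver-incidence X A B = begin
    sumFin nV (λ v → [ X v ]· sumFin nE (λ e → [ ⌊ s e ≟ v ⌋ ]· A e v + [ ⌊ t e ≟ v ⌋ ]· B e v))
      ≡⟨ sumFin-cong nV (λ v → sym (sumFin-[]· nE (X v) _)) ⟩
    sumFin nV (λ v → sumFin nE (λ e → [ X v ]· ([ ⌊ s e ≟ v ⌋ ]· A e v + [ ⌊ t e ≟ v ⌋ ]· B e v)))
      ≡⟨ sumFin-comm nV nE _ ⟩
    sumFin nE (λ e → sumFin nV (λ v → [ X v ]· ([ ⌊ s e ≟ v ⌋ ]· A e v + [ ⌊ t e ≟ v ⌋ ]· B e v)))
      ≡⟨ sumFin-cong nE (λ e → trans (sumFin-cong nV (λ v → per-vertex e v)) (sumFin-distrib-+ nV _ _)) ⟩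
    sumFin nE (λ e → sumFin nV (λ v → [ ⌊ s e ≟ v ⌋ ]· [ X v ]· A e v) + sumFin nV (λ v → [ ⌊ t e ≟ v ⌋ ]· [ X v ]· B e v))
      ≡⟨ sumFin-cong nE (λ e → cong₂ _+_ (sumFin-δ nV (s e) _) (sumFin-δ nV (t e) _)) ⟩
    sumFin nE (λ e → [ X (s e) ]· A e (s e) + [ X (t e) ]· B e (t e)) ∎
    where
    open ≡-Reasoning
    per-vertex : ∀ e v → [ X v ]· ([ ⌊ s e ≟ v ⌋ ]· A e v + [ ⌊ t e ≟ v ⌋ ]· B e v) ≡
                         [ ⌊ s e ≟ v ⌋ ]· [ X v ]· A e v + [ ⌊ t e ≟ v ⌋ ]· [ X v ]· B e v
    per-vertex e v = trans ([]·-distrib-+ (X v) ([ ⌊ s e ≟ v ⌋ ]· A e v) ([ ⌊ t e ≟ v ⌋ ]· B e v))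
      (cong₂ _+_ ([]·-comm (X v) ⌊ s e ≟ v ⌋ (A e v)) ([]·-comm (X v) ⌊ t e ≟ v ⌋ (B e v)))

  sumOver-αd : ∀ X → sumOver X (αd m col d) ≡ sumFin nE (λ e → gain (X (s e)) (X (t e)) (col (s e)) (col (t e)))
  sumOver-αd X = trans (sumFin-cong nV (λ v → cong ([ X v ]·_) (αd≡ v)))
    (sumOver-incidence X (λ _ v → colourWeight d (col v)) (λ _ v → colourWeight d (col v)))
    where
    αd≡ : ∀ v → αd m col d v ≡ sumFin nE (λ e → [ ⌊ s e ≟ v ⌋ ]· colourWeight d (col v) + [ ⌊ t e ≟ v ⌋ ]· colourWeight d (col v))
    αd≡ v = trans (αd-as-product v) (trans (*-distribˡ-sumFin nE (colourWeight d (col v)) _)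
      (sumFin-cong nE (λ e → trans (*-distribˡ-+ w ([ ⌊ s e ≟ v ⌋ ]· 1) _)
        (cong₂ _+_ (*-[]·1 w ⌊ s e ≟ v ⌋) (*-[]·1 w ⌊ t e ≟ v ⌋)))))
      where
      w : ℕ
      w = colourWeight d (col v)
      αd-as-product : ∀ v → αd m col d v ≡ colourWeight d (col v) * deg m v
      αd-as-product v with col v
      ... | black = refl
      ... | white = sym (*-identityˡ _)

  sumOver-outdeg : ∀ X O → sumOver X (outdeg m col d O) ≡ sumFin nE (λ e → edgeOut (X (s e)) (X (t e)) (O (e , true)) (O (e , false)))
  sumOver-outdeg X O = sumOver-incidence X (λ e _ → O (e , true)) (λ e _ → O (e , false))

  proper⇒loopless : ProperColouring m col → ∀ e → s e ≢ t e
  proper⇒loopless proper e s≡t = proper (e , true) (cong col s≡t)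

  inner+boundary≤αd : 1 ≤ d → ProperColouring m col → ∀ X → inner s t X + boundary X ≤ sumOver X (αd m col d)
  inner+boundary≤αd 1≤d proper X = begin
    inner s t X + boundary X  ≡⟨ sym (sumFin-distrib-+ nE _ _) ⟩
    sumFin nE (λ e → [ X (s e) ∧ X (t e) ]· D + crossing (X (s e)) (X (t e)))
      ≤⟨ sumFin-mono-≤ nE (λ e → gain-≥ 1≤d (X (s e)) (X (t e)) (proper (e , true))) ⟩
    sumFin nE (λ e → gain (X (s e)) (X (t e)) (col (s e)) (col (t e)))  ≡⟨ sym (sumOver-αd X) ⟩
    sumOver X (αd m col d)    ∎
    where open ≤-Reasoning

  inner+boundary+[d∸1]≤αd : 1 ≤ d → ProperColouring m col → ∀ X e → blackExits X e ≡ true →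
    inner s t X + boundary X + (d ∸ 1) ≤ sumOver X (αd m col d)
  inner+boundary+[d∸1]≤αd 1≤d proper X e₀ black-exit = begin
    inner s t X + boundary X + (d ∸ 1)  ≡⟨ cong (_+ (d ∸ 1)) (sym (sumFin-distrib-+ nE _ _)) ⟩
    sumFin nE (λ e → [ X (s e) ∧ X (t e) ]· D + crossing (X (s e)) (X (t e))) + (d ∸ 1)
      ≤⟨ sumFin-mono-≤-at nE (d ∸ 1) e₀ (λ e → gain-≥ 1≤d (X (s e)) (X (t e)) (proper (e , true)))
           (gain-≥-blackExit 1≤d (X (s e₀)) (X (t e₀)) (col (s e₀)) (col (t e₀)) black-exit) ⟩
    sumFin nE (λ e → gain (X (s e)) (X (t e)) (col (s e)) (col (t e)))  ≡⟨ sym (sumOver-αd X) ⟩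
    sumOver X (αd m col d)    ∎
    where open ≤-Reasoning

  αd≤inner+boundary : ProperColouring m col → ∀ X → BoundaryColour X white →
    sumOver X (αd m col d) ≤ inner s t X + boundary X
  αd≤inner+boundary proper X white-exits = begin
    sumOver X (αd m col d)    ≡⟨ sumOver-αd X ⟩
    sumFin nE (λ e → gain (X (s e)) (X (t e)) (col (s e)) (col (t e)))
      ≤⟨ sumFin-mono-≤ nE (λ e → gain-≤-whiteExits (X (s e)) (X (t e)) (proper (e , true)) (exitsColoured {X} white-exits e)) ⟩
    sumFin nE (λ e → [ X (s e) ∧ X (t e) ]· D + crossing (X (s e)) (X (t e)))  ≡⟨ sumFin-distrib-+ nE _ _ ⟩
    inner s t X + boundary X  ∎
    where open ≤-Reasoning

  inner+d*boundary≤αd : ProperColouring m col → ∀ X → BoundaryColour X black →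
    inner s t X + d * boundary X ≤ sumOver X (αd m col d)
  inner+d*boundary≤αd proper X black-exits = begin
    inner s t X + d * boundary X  ≡⟨ cong (inner s t X +_) (*-distribˡ-sumFin nE d _) ⟩
    inner s t X + sumFin nE (λ e → d * crossing (X (s e)) (X (t e)))  ≡⟨ sym (sumFin-distrib-+ nE _ _) ⟩
    sumFin nE (λ e → [ X (s e) ∧ X (t e) ]· D + d * crossing (X (s e)) (X (t e)))
      ≤⟨ sumFin-mono-≤ nE (λ e → gain-≥-blackExits (X (s e)) (X (t e)) (proper (e , true)) (exitsColoured {X} black-exits e)) ⟩
    sumFin nE (λ e → gain (X (s e)) (X (t e)) (col (s e)) (col (t e)))  ≡⟨ sym (sumOver-αd X) ⟩
    sumOver X (αd m col d)        ∎
    where open ≤-Reasoning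

  module _ (O : HE m → ℕ) (frac : FracOrientation m col d O) where

    outdeg≤inner+D*boundary : ∀ X → sumOver X (outdeg m col d O) ≤ inner s t X + D * boundary X
    outdeg≤inner+D*boundary X = begin
      sumOver X (outdeg m col d O)  ≡⟨ sumOver-outdeg X O ⟩
      sumFin nE (λ e → edgeOut (X (s e)) (X (t e)) (O (e , true)) (O (e , false)))
        ≤⟨ sumFin-mono-≤ nE (λ e → edgeOut-≤ (X (s e)) (X (t e)) (frac (e , true))) ⟩
      sumFin nE (λ e → [ X (s e) ∧ X (t e) ]· D + D * crossing (X (s e)) (X (t e)))  ≡⟨ sumFin-distrib-+ nE _ _ ⟩
      inner s t X + sumFin nE (λ e → D * crossing (X (s e)) (X (t e)))  ≡⟨ cong (inner s t X +_) (sym (*-distribˡ-sumFin nE D _)) ⟩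
      inner s t X + D * boundary X  ∎
      where open ≤-Reasoning

    inner≤outdeg : ∀ X → inner s t X ≤ sumOver X (outdeg m col d O)
    inner≤outdeg X = ≤-trans (sumFin-mono-≤ nE (λ e → edgeOut-≥ (X (s e)) (X (t e)) (frac (e , true))))
      (≤-reflexive (sym (sumOver-outdeg X O)))

    inner<outdeg : ∀ X h → X (vert h) ≡ true → X (vert (ι h)) ≡ false → 0 < O h →
      inner s t X + 1 ≤ sumOver X (outdeg m col d O)
    inner<outdeg X (e₀ , b) inside outside forward =
      ≤-trans (sumFin-mono-≤-at nE 1 e₀ (λ e → edgeOut-≥ (X (s e)) (X (t e)) (frac (e , true))) (at-exit b inside outside forward))
        (≤-reflexive (sym (sumOver-outdeg X O)))
      where
      at-exit : ∀ b → X (vert (e₀ , b)) ≡ true → X (vert (ι (e₀ , b))) ≡ false → 0 < O (e₀ , b) →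
        [ X (s e₀) ∧ X (t e₀) ]· D + 1 ≤ edgeOut (X (s e₀)) (X (t e₀)) (O (e₀ , true)) (O (e₀ , false))
      at-exit true  xs xt forward rewrite xs | xt = edgeOut-≥-exit₁ (O (e₀ , false)) forward
      at-exit false xt xs forward rewrite xs | xt = edgeOut-≥-exit₂ (O (e₀ , true)) forward

    outdeg≤inner : ∀ X → (∀ h → X (vert h) ≡ true → X (vert (ι h)) ≡ false → O h ≡ 0) →
      sumOver X (outdeg m col d O) ≤ inner s t X
    outdeg≤inner X no-exit = ≤-trans (≤-reflexive (sumOver-outdeg X O))
      (sumFin-mono-≤ nE (λ e → edgeOut-≤-noExit (X (s e)) (X (t e)) (frac (e , true)) (no-exit (e , true)) (no-exit (e , false))))

  walk-exits : ∀ (X : Fin nV → Bool) {u w} → Walk m u w → X u ≡ true → X w ≡ false →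
    ∃ λ h → X (vert h) ≡ true × X (vert (ι h)) ≡ false
  walk-exits X wnil                   xu xw = ⊥-elim (Bool.not-¬ xu xw)
  walk-exits X (wcons h refl rest) xu xw with X (vert (ι h)) in next
  ... | false = h , xu , next
  ... | true  = walk-exits X rest next xw

  fpath-exits : ∀ (X : Fin nV → Bool) O {u w} → FPath m col d O u w → X u ≡ true → X w ≡ false →
    ∃ λ h → X (vert h) ≡ true × X (vert (ι h)) ≡ false × 0 < O h
  fpath-exits X O fnil                         xu xw = ⊥-elim (Bool.not-¬ xu xw)
  fpath-exits X O (fcons h refl forward rest) xu xw with X (vert (ι h)) in next
  ... | false = h , xu , next , forward
  ... | true  = fpath-exits X O rest next xw

  exit⇒1≤boundary : ∀ (X : Fin nV → Bool) h → X (vert h) ≡ true → X (vert (ι h)) ≡ false → 1 ≤ boundary X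
  exit⇒1≤boundary X (e , true)  xs xt = ≤-trans (≤-reflexive (sym (cong₂ crossing xs xt))) (term≤sumFin nE _ e)
  exit⇒1≤boundary X (e , false) xt xs = ≤-trans (≤-reflexive (sym (cong₂ crossing xs xt))) (term≤sumFin nE _ e)

  connected⇒1≤boundary : Connected m → ∀ (X : Fin nV → Bool) {u w} → X u ≡ true → X w ≡ false → 1 ≤ boundary X
  connected⇒1≤boundary connected X xu xw with walk-exits X (connected _ _) xu xw
  ... | h , xs , xt = exit⇒1≤boundary X h xs xt

  module Reachability (O : HE m → ℕ) (ρ : Fin nV) where

    Reaches : (Fin nV → Bool) → Set
    Reaches A = ∀ v → A v ≡ true → FPath m col d O v ρ

    NoForwardEntry : (Fin nV → Bool) → Set
    NoForwardEntry A = ∀ h → A (vert h) ≡ false → 0 < O h → A (vert (ι h)) ≡ false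

    EntersVia : (Fin nV → Bool) → Fin nV → Fin nE → Set
    EntersVia A v e = (s e ≡ v × 0 < O (e , true) × A (t e) ≡ true) ⊎ (t e ≡ v × 0 < O (e , false) × A (s e) ≡ true)

    entersVia? : ∀ A v → Decidable (EntersVia A v)
    entersVia? A v e = (s e ≟ v ×-dec 0 <? O (e , true) ×-dec A (t e) Bool.≟ true)
                 ⊎-dec (t e ≟ v ×-dec 0 <? O (e , false) ×-dec A (s e) Bool.≟ true)

    extend : (Fin nV → Bool) → Fin nV → Bool
    extend A v = A v ∨ ⌊ Fin.any? (entersVia? A v) ⌋

    extend-reaches : ∀ A → Reaches A → Reaches (extend A)
    extend-reaches A reaches v ev with A v in av | Fin.any? (entersVia? A v)
    ... | true  | _ = reaches v av
    ... | false | yes (e , inj₁ (refl , forward , at)) = fcons (e , true)  refl forward (reaches (t e) at)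
    ... | false | yes (e , inj₂ (refl , forward , as)) = fcons (e , false) refl forward (reaches (s e) as)

    extend-entered : ∀ A h → 0 < O h → A (vert (ι h)) ≡ true → extend A (vert h) ≡ true
    extend-entered A (e , true) forward at with A (s e) | Fin.any? (entersVia? A (s e))
    ... | true  | _      = refl
    ... | false | yes _  = refl
    ... | false | no none = ⊥-elim (none (e , inj₁ (refl , forward , at)))
    extend-entered A (e , false) forward as with A (t e) | Fin.any? (entersVia? A (t e))
    ... | true  | _      = refl
    ... | false | yes _  = refl
    ... | false | no none = ⊥-elim (none (e , inj₂ (refl , forward , as)))

    noForwardEntry⇒noForwardExit : ∀ A → NoForwardEntry A →
      ∀ h → not (A (vert h)) ≡ true → not (A (vert (ι h))) ≡ false → O h ≡ 0
    noForwardEntry⇒noForwardExit A closed h outside inside with O h in oh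
    ... | zero  = refl
    ... | suc _ = ⊥-elim (Bool.not-¬ inside (cong not (closed h (Bool.not-injective outside) (subst (0 <_) (sym oh) (s≤s z≤n)))))

    size : (Fin nV → Bool) → ℕ
    size A = sumFin nV (λ v → [ A v ]· 1)

    -- Every round that changes A adds a vertex, so nV ∸ size A rounds of extend reach a fixed point.
    closure-from : ∀ fuel A → Reaches A → A ρ ≡ true → nV ≤ fuel + size A →
      ∃ λ B → Reaches B × B ρ ≡ true × NoForwardEntry B
    closure-from fuel A reaches aρ bound with Fin.any? (λ v → extend A v Bool.≟ true ×-dec A v Bool.≟ false)
    ... | no unchanged = A , reaches , aρ , closed
      where
      closed : NoForwardEntry A
      closed h outside forward with A (vert (ι h)) in inside
      ... | false = refl
      ... | true  = ⊥-elim (unchanged (vert h , extend-entered A h forward inside , outside))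
    ... | yes (v₀ , new , old) = recurse fuel bound
      where
      size-grows : size A + 1 ≤ size (extend A)
      size-grows = sumFin-mono-≤-at nV 1 v₀ (λ v → []·-mono-∨ (A v) _ 1)
        (subst₂ (λ a b → [ a ]· 1 + 1 ≤ [ b ]· 1) (sym old) (sym new) ≤-refl)
      size-bounded : size A + 1 ≤ nV
      size-bounded = ≤-trans (sumFin-mono-≤-at nV 1 v₀ (λ v → []·-≤ (A v) 1) (subst (λ a → [ a ]· 1 + 1 ≤ 1) (sym old) ≤-refl))
        (≤-reflexive (sumFin-const-1 nV))
      recurse : ∀ fuel → nV ≤ fuel + size A → ∃ λ B → Reaches B × B ρ ≡ true × NoForwardEntry B
      recurse zero    bound = ⊥-elim (<-irrefl refl (≤-trans (≤-reflexive (+-comm 1 (size A))) (≤-trans size-bounded bound)))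
      recurse (suc f) bound = closure-from f (extend A) (extend-reaches A reaches) (cong (_∨ ⌊ Fin.any? (entersVia? A ρ) ⌋) aρ)
        (≤-trans bound (≤-trans (≤-reflexive (sym (+-suc f (size A)))) (+-monoʳ-≤ f (≤-trans (≤-reflexive (+-comm 1 (size A))) size-grows))))

    closure : ∃ λ B → Reaches B × B ρ ≡ true × NoForwardEntry B
    closure = closure-from nV ⁅ ρ ⁆ (λ v at → subst (FPath m col d O v) (⌊≟⌋-sound at) fnil) (⌊≟⌋-refl ρ) (m≤m+n nV _)

  sumOver-⁅⁆-scaled : ∀ X u k → sumOver X (λ v → [ ⌊ v ≟ u ⌋ ]· k) ≡ [ X u ]· k
  sumOver-⁅⁆-scaled X u k = trans (sumFin-cong nV (λ v → []·-comm (X v) ⌊ v ≟ u ⌋ k)) (sumFin-δ′ nV u (λ v → [ X v ]· k))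

  sumOver-transfer : ∀ X k u w (f g : Fin nV → ℕ) → (∀ v → f v + [ ⌊ v ≟ u ⌋ ]· k ≡ g v + [ ⌊ v ≟ w ⌋ ]· k) →
    sumOver X f + [ X u ]· k ≡ sumOver X g + [ X w ]· k
  sumOver-transfer X k u w f g f≡g = begin
    sumOver X f + [ X u ]· k                               ≡⟨ cong (sumOver X f +_) (sym (sumOver-⁅⁆-scaled X u k)) ⟩
    sumOver X f + sumOver X (λ v → [ ⌊ v ≟ u ⌋ ]· k)       ≡⟨ sym (sumOver-distrib-+ X f _) ⟩
    sumOver X (λ v → f v + [ ⌊ v ≟ u ⌋ ]· k)               ≡⟨ sumFin-cong nV (λ v → cong ([ X v ]·_) (f≡g v)) ⟩
    sumOver X (λ v → g v + [ ⌊ v ≟ w ⌋ ]· k)               ≡⟨ sumOver-distrib-+ X g _ ⟩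
    sumOver X g + sumOver X (λ v → [ ⌊ v ≟ w ⌋ ]· k)       ≡⟨ cong (sumOver X g +_) (sumOver-⁅⁆-scaled X w k) ⟩
    sumOver X g + [ X w ]· k                               ∎
    where open ≡-Reasoning

  sumOver-αd-total : ProperColouring m col → sumOver (λ _ → true) (αd m col d) ≡ sumFin nE (λ _ → D)
  sumOver-αd-total proper = trans (sumOver-αd (λ _ → true)) (sumFin-cong nE (λ e → colourWeight-+ d (proper (e , true))))

  blackExit⇒1≤boundary : ∀ X e → blackExits X e ≡ true → 1 ≤ boundary X
  blackExit⇒1≤boundary X e black-exit =
    ≤-trans (blackExit⇒1≤crossing (X (s e)) (X (t e)) (col (s e)) (col (t e)) black-exit) (term≤sumFin nE _ e)

  -- Hakimi's condition for αd with k units of demand moved from u to w.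
  hakimi-condition : 1 ≤ d → ∀ {k} → k ≤ d → ProperColouring m col → ∀ u w X →
    (X u ≡ true → X w ≡ false → (∀ e → blackExits X e ≡ false) → k ≤ boundary X) →
    inner s t X + [ X u ]· k ≤ sumOver X (αd m col d) + [ X w ]· k
  hakimi-condition 1≤d {k} k≤d proper u w X small-cut with Fin.any? (λ e → blackExits X e Bool.≟ true)
  ... | yes (e , black-exit) = begin
    inner s t X + [ X u ]· k                 ≤⟨ +-monoʳ-≤ (inner s t X) (≤-trans ([]·-≤ (X u) k) k≤d) ⟩
    inner s t X + d                          ≡⟨ cong (inner s t X +_) (sym (m+[n∸m]≡n 1≤d)) ⟩
    inner s t X + (1 + (d ∸ 1))              ≤⟨ +-monoʳ-≤ (inner s t X) (+-monoˡ-≤ (d ∸ 1) (blackExit⇒1≤boundary X e black-exit)) ⟩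
    inner s t X + (boundary X + (d ∸ 1))     ≡⟨ sym (+-assoc (inner s t X) _ _) ⟩
    inner s t X + boundary X + (d ∸ 1)       ≤⟨ inner+boundary+[d∸1]≤αd 1≤d proper X e black-exit ⟩
    sumOver X (αd m col d)                   ≤⟨ m≤m+n _ _ ⟩
    sumOver X (αd m col d) + [ X w ]· k      ∎
    where open ≤-Reasoning
  ... | no no-black-exit = by-cases (X u) (X w) refl refl
    where
    inner≤αd : inner s t X ≤ sumOver X (αd m col d)
    inner≤αd = m+n≤o⇒m≤o _ (inner+boundary≤αd 1≤d proper X)
    by-cases : ∀ bu bw → X u ≡ bu → X w ≡ bw → inner s t X + [ bu ]· k ≤ sumOver X (αd m col d) + [ bw ]· k
    by-cases true  false xu xw = ≤-trans
      (+-monoʳ-≤ (inner s t X) (small-cut xu xw (λ e → Bool.¬-not (λ black-exit → no-black-exit (e , black-exit)))))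
      (≤-trans (inner+boundary≤αd 1≤d proper X) (m≤m+n _ _))
    by-cases true  true  xu xw = +-monoˡ-≤ k inner≤αd
    by-cases false bw    xu xw = ≤-trans (≤-reflexive (+-identityʳ _)) (≤-trans inner≤αd (m≤m+n _ _))

  orientation-from-condition : ProperColouring m col → ∀ k u w → w ≢ u →
    (∀ X → inner s t X + [ X u ]· k ≤ sumOver X (αd m col d) + [ X w ]· k) →
    ∃ λ O → FracOrientation m col d O × (∀ v → outdeg m col d O v + [ ⌊ v ≟ u ⌋ ]· k ≡ αd m col d v + [ ⌊ v ≟ w ⌋ ]· k)
  orientation-from-condition proper k u w w≢u condition = O , frac , outdeg≡
    where
    k≤αd-u : k ≤ αd m col d u
    k≤αd-u = begin
      k                                   ≡⟨ cong ([_]· k) (sym (⌊≟⌋-refl u)) ⟩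
      [ ⁅ u ⁆ u ]· k                      ≤⟨ m≤n+m _ _ ⟩
      inner s t ⁅ u ⁆ + [ ⁅ u ⁆ u ]· k    ≤⟨ condition ⁅ u ⁆ ⟩
      sumOver ⁅ u ⁆ (αd m col d) + [ ⁅ u ⁆ w ]· k  ≡⟨ cong₂ _+_ (sumOver-⁅⁆ u (αd m col d)) (cong ([_]· k) (⌊≟⌋-≢ w≢u)) ⟩
      αd m col d u + 0                    ≡⟨ +-identityʳ _ ⟩
      αd m col d u                        ∎
      where open ≤-Reasoning
    demand : Fin nV → ℕ
    demand v = (αd m col d v + [ ⌊ v ≟ w ⌋ ]· k) ∸ [ ⌊ v ≟ u ⌋ ]· k
    demand-shift : ∀ v → demand v + [ ⌊ v ≟ u ⌋ ]· k ≡ αd m col d v + [ ⌊ v ≟ w ⌋ ]· k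
    demand-shift v = m∸n+n≡m (shift≤ v)
      where
      shift≤ : ∀ v → [ ⌊ v ≟ u ⌋ ]· k ≤ αd m col d v + [ ⌊ v ≟ w ⌋ ]· k
      shift≤ v with v ≟ u
      ... | yes refl = ≤-trans k≤αd-u (m≤m+n _ _)
      ... | no  _    = z≤n
    demand-condition : ∀ X → inner s t X ≤ sumOver X demand
    demand-condition X = +-cancelʳ-≤ ([ X u ]· k) _ _
      (≤-trans (condition X) (≤-reflexive (sym (sumOver-transfer X k u w demand (αd m col d) demand-shift))))
    demand-total : sumFin nE (λ _ → D) ≡ sumFin nV demand
    demand-total = sym (trans (+-cancelʳ-≡ k _ _ (sumOver-transfer (λ _ → true) k u w demand (αd m col d) demand-shift))
      (sumOver-αd-total proper))
    solution : ∃ λ x → (∀ e → x e ≤ D) × (∀ v → out s t x v ≡ demand v)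
    solution = hakimi nE s t (proper⇒loopless proper) demand demand-condition demand-total
    x : Fin nE → ℕ
    x = proj₁ solution
    O : HE m → ℕ
    O (e , true)  = x e
    O (e , false) = D ∸ x e
    frac : FracOrientation m col d O
    frac (e , true)  = m+[n∸m]≡n (proj₁ (proj₂ solution) e)
    frac (e , false) = m∸n+n≡m (proj₁ (proj₂ solution) e)
    outdeg≡ : ∀ v → outdeg m col d O v + [ ⌊ v ≟ u ⌋ ]· k ≡ αd m col d v + [ ⌊ v ≟ w ⌋ ]· k
    outdeg≡ v = trans (cong (_+ [ ⌊ v ≟ u ⌋ ]· k) (proj₂ (proj₂ solution) v)) (demand-shift v)

-- Data.Integer's +_ is opened only here: elsewhere it would make sections of ℕ's _+_ ambiguous.
module _ where
  open import Data.Integer using (+_)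

  +-≡-−+ : ∀ a p A q → (+ a ≡ (+ A ℤ.- + p) ℤ.+ + q) ⇔ (a + p ≡ A + q)
  +-≡-−+ a p A q = mk⇔ to from
    where
    open ≡-Reasoning
    to : + a ≡ (+ A ℤ.- + p) ℤ.+ + q → a + p ≡ A + q
    to a≡ = ℤ.+-injective (begin
      + a ℤ.+ + p                      ≡⟨ cong (ℤ._+ + p) a≡ ⟩
      ((+ A ℤ.- + p) ℤ.+ + q) ℤ.+ + p  ≡⟨ cancel (+ A) (+ p) (+ q) ⟩
      + A ℤ.+ + q                      ∎)
      where
      cancel : ∀ x y z → ((x ℤ.- y) ℤ.+ z) ℤ.+ y ≡ x ℤ.+ z
      cancel = ℤ.solve-∀
    from : a + p ≡ A + q → + a ≡ (+ A ℤ.- + p) ℤ.+ + q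
    from a+p≡A+q = begin
      + a                          ≡⟨ cancel (+ a) (+ p) ⟩
      (+ a ℤ.+ + p) ℤ.- + p        ≡⟨ cong (λ z → + z ℤ.- + p) a+p≡A+q ⟩
      (+ A ℤ.+ + q) ℤ.- + p        ≡⟨ swap (+ A) (+ p) (+ q) ⟩
      (+ A ℤ.- + p) ℤ.+ + q        ∎
      where
      cancel : ∀ x y → x ≡ (x ℤ.+ y) ℤ.- y
      cancel = ℤ.solve-∀
      swap : ∀ x y z → (x ℤ.+ z) ℤ.- y ≡ (x ℤ.- y) ℤ.+ z
      swap = ℤ.solve-∀

  +-≡-+− : ∀ a p A q → (+ a ≡ (+ A ℤ.+ + p) ℤ.- + q) ⇔ (a + q ≡ A + p)
  +-≡-+− a p A q = mk⇔ to from
    where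
    open ≡-Reasoning
    to : + a ≡ (+ A ℤ.+ + p) ℤ.- + q → a + q ≡ A + p
    to a≡ = ℤ.+-injective (begin
      + a ℤ.+ + q                      ≡⟨ cong (ℤ._+ + q) a≡ ⟩
      ((+ A ℤ.+ + p) ℤ.- + q) ℤ.+ + q  ≡⟨ cancel (+ A ℤ.+ + p) (+ q) ⟩
      + A ℤ.+ + p                      ∎)
      where
      cancel : ∀ x y → (x ℤ.- y) ℤ.+ y ≡ x
      cancel = ℤ.solve-∀
    from : a + q ≡ A + p → + a ≡ (+ A ℤ.+ + p) ℤ.- + q
    from a+q≡A+p = begin
      + a                          ≡⟨ cancel (+ a) (+ q) ⟩
      (+ a ℤ.+ + q) ℤ.- + q        ≡⟨ cong (λ z → + z ℤ.- + q) a+q≡A+p ⟩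
      (+ A ℤ.+ + p) ℤ.- + q        ∎
      where
      cancel : ∀ x y → x ≡ (x ℤ.+ y) ℤ.- y
      cancel = ℤ.solve-∀

  module Demands (m : Map) (col : Vertex m → Colour) (d k : ℕ) (ρ τ : Vertex m) where
    open Map m

    Balanced⁻ Balanced⁺ : (HE m → ℕ) → Set
    Balanced⁻ O = ∀ v → outdeg m col d O v + [ ⌊ v ≟ ρ ⌋ ]· k ≡ αd m col d v + [ ⌊ v ≟ τ ⌋ ]· k
    Balanced⁺ O = ∀ v → outdeg m col d O v + [ ⌊ v ≟ τ ⌋ ]· k ≡ αd m col d v + [ ⌊ v ≟ ρ ⌋ ]· k

    ind≡ : ∀ x v → ind m col d k ρ τ x v ≡ + [ ⌊ v ≟ x ⌋ ]· k
    ind≡ x v with ⌊ v ≟ x ⌋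
    ... | true  = refl
    ... | false = refl

    α⁻≡ : ∀ v → α⁻ m col d k ρ τ v ≡ (+ αd m col d v ℤ.- + [ ⌊ v ≟ ρ ⌋ ]· k) ℤ.+ + [ ⌊ v ≟ τ ⌋ ]· k
    α⁻≡ v = cong₂ (λ P Q → (+ αd m col d v ℤ.- P) ℤ.+ Q) (ind≡ ρ v) (ind≡ τ v)

    α⁺≡ : ∀ v → α⁺ m col d k ρ τ v ≡ (+ αd m col d v ℤ.+ + [ ⌊ v ≟ ρ ⌋ ]· k) ℤ.- + [ ⌊ v ≟ τ ⌋ ]· k
    α⁺≡ v = cong₂ (λ P Q → (+ αd m col d v ℤ.+ P) ℤ.- Q) (ind≡ ρ v) (ind≡ τ v)

    α⁻-orientation⇔ : ∀ O → IsOrientation m col d (α⁻ m col d k ρ τ) O ⇔ (FracOrientation m col d O × Balanced⁻ O)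
    α⁻-orientation⇔ O = mk⇔
      (λ (frac , out≡α) → frac , λ v → Equivalence.to (spec v) (trans (out≡α v) (α⁻≡ v)))
      (λ (frac , bal) → frac , λ v → trans (Equivalence.from (spec v) (bal v)) (sym (α⁻≡ v)))
      where
      spec : ∀ v → (+ outdeg m col d O v ≡ (+ αd m col d v ℤ.- + [ ⌊ v ≟ ρ ⌋ ]· k) ℤ.+ + [ ⌊ v ≟ τ ⌋ ]· k)
                   ⇔ (outdeg m col d O v + [ ⌊ v ≟ ρ ⌋ ]· k ≡ αd m col d v + [ ⌊ v ≟ τ ⌋ ]· k)
      spec v = +-≡-−+ (outdeg m col d O v) ([ ⌊ v ≟ ρ ⌋ ]· k) (αd m col d v) ([ ⌊ v ≟ τ ⌋ ]· k)

    α⁺-orientation⇔ : ∀ O → IsOrientation m col d (α⁺ m col d k ρ τ) O ⇔ (FracOrientation m col d O × Balanced⁺ O)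
    α⁺-orientation⇔ O = mk⇔
      (λ (frac , out≡α) → frac , λ v → Equivalence.to (spec v) (trans (out≡α v) (α⁺≡ v)))
      (λ (frac , bal) → frac , λ v → trans (Equivalence.from (spec v) (bal v)) (sym (α⁺≡ v)))
      where
      spec : ∀ v → (+ outdeg m col d O v ≡ (+ αd m col d v ℤ.+ + [ ⌊ v ≟ ρ ⌋ ]· k) ℤ.- + [ ⌊ v ≟ τ ⌋ ]· k)
                   ⇔ (outdeg m col d O v + [ ⌊ v ≟ τ ⌋ ]· k ≡ αd m col d v + [ ⌊ v ≟ ρ ⌋ ]· k)
      spec v = +-≡-+− (outdeg m col d O v) ([ ⌊ v ≟ ρ ⌋ ]· k) (αd m col d v) ([ ⌊ v ≟ τ ⌋ ]· k)

module TrumpetsAndCornets (m : Map) (col : Vertex m → Colour) (proper : ProperColouring m col)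
            (d k : ℕ) (ρ τ : Vertex m) (τ≢ρ : τ ≢ ρ) (deg-τ : deg m τ ≡ k) where
  open Map m
  open MapAccounting m col d
  open Demands m col d k ρ τ

  weight-trivialCut : weight m col ρ τ (trivialCut m col ρ τ) ≡ k
  weight-trivialCut = trans (sumFin-cong nE per-edge) deg-τ
    where
    per-edge : ∀ e → crossing ⌊ s e ≟ τ ⌋ ⌊ t e ≟ τ ⌋ ≡ [ ⌊ s e ≟ τ ⌋ ]· 1 + [ ⌊ t e ≟ τ ⌋ ]· 1
    per-edge e with s e ≟ τ | t e ≟ τ
    ... | yes s≡τ | yes t≡τ = ⊥-elim (proper⇒loopless proper e (trans s≡τ (sym t≡τ)))
    ... | yes _   | no  _   = refl
    ... | no  _   | yes _   = refl
    ... | no  _   | no  _   = refl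

  tight⇒α⁻-feasible : 1 ≤ d → k ≤ d → Tight m col ρ τ → col τ ≡ black → Feasible m col d (α⁻ m col d k ρ τ)
  tight⇒α⁻-feasible 1≤d k≤d tight τ-black
    with orientation-from-condition proper k ρ τ τ≢ρ (λ X → hakimi-condition 1≤d k≤d proper ρ τ X (complement-cut X))
    where
    complement-cut : ∀ X → X ρ ≡ true → X τ ≡ false → (∀ e → blackExits X e ≡ false) → k ≤ boundary X
    complement-cut X xρ xτ no-black = subst₂ _≤_ weight-trivialCut (boundary-complement X)
      (tight (not ∘ X) (cong not xρ , cong not xτ)
        (subst (BoundaryColour (not ∘ X)) (sym τ-black) (complement-blackBoundary proper X (whiteBoundary X no-black))))
  ... | O , frac , balanced = O , Equivalence.from (α⁻-orientation⇔ O) (frac , balanced)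

  α⁻-orientation⇒tight : ∀ O → FracOrientation m col d O × Balanced⁻ O → col τ ≡ black → Tight m col ρ τ
  α⁻-orientation⇒tight O (frac , balanced) τ-black S (sρ , sτ) cut-colour =
    subst (_≤ boundary S) (sym weight-trivialCut) (+-cancelˡ-≤ (inner s t S + d * boundary S) k (boundary S) (begin
      inner s t S + d * boundary S + k   ≤⟨ +-monoˡ-≤ k (inner+d*boundary≤αd proper S (subst (BoundaryColour S) τ-black cut-colour)) ⟩
      sumOver S (αd m col d) + k         ≡⟨ sym out≡αd+k ⟩
      sumOver S (outdeg m col d O)       ≤⟨ outdeg≤inner+D*boundary O frac S ⟩
      inner s t S + D * boundary S       ≡⟨ +-comm-middle (inner s t S) (boundary S) (d * boundary S) ⟩
      inner s t S + d * boundary S + boundary S ∎))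
    where
    open ≤-Reasoning
    out≡αd+k : sumOver S (outdeg m col d O) ≡ sumOver S (αd m col d) + k
    out≡αd+k = trans (sym (+-identityʳ _))
      (subst₂ (λ x y → sumOver S (outdeg m col d O) + [ x ]· k ≡ sumOver S (αd m col d) + [ y ]· k) sρ sτ
        (sumOver-transfer S k ρ τ _ _ balanced))
    +-comm-middle : ∀ a b c → a + (b + c) ≡ a + c + b
    +-comm-middle = ℕ.solve-∀

  α⁻-orientation⇒accessible : 1 ≤ d → Connected m → ∀ O → FracOrientation m col d O × Balanced⁻ O → Accessible m col d ρ O
  α⁻-orientation⇒accessible 1≤d connected O (frac , balanced) v with Reachability.closure O ρ
  ... | A , reaches , aρ , closed with A v in av
  ...   | true  = reaches v av
  ...   | false = ⊥-elim (<-irrefl refl (≤-trans (connected⇒1≤boundary connected S (cong not av) (cong not aρ)) boundary≤0))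
    where
    S : Fin nV → Bool
    S = not ∘ A
    boundary≤0 : boundary S ≤ 0
    boundary≤0 = +-cancelˡ-≤ (inner s t S) _ _ (begin
      inner s t S + boundary S                   ≤⟨ inner+boundary≤αd 1≤d proper S ⟩
      sumOver S (αd m col d)                     ≤⟨ m≤m+n _ _ ⟩
      sumOver S (αd m col d) + [ S τ ]· k        ≡⟨ sym (sumOver-transfer S k ρ τ _ _ balanced) ⟩
      sumOver S (outdeg m col d O) + [ S ρ ]· k  ≡⟨ cong (λ b → sumOver S (outdeg m col d O) + [ b ]· k) (cong not aρ) ⟩
      sumOver S (outdeg m col d O) + 0           ≡⟨ +-identityʳ _ ⟩
      sumOver S (outdeg m col d O)               ≤⟨ outdeg≤inner O frac S (Reachability.noForwardEntry⇒noForwardExit O ρ A closed) ⟩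
      inner s t S                                ≡⟨ sym (+-identityʳ _) ⟩
      inner s t S + 0                            ∎)
      where open ≤-Reasoning

  cut-bound-α⁺ : col τ ≡ white → ∀ O → Balanced⁺ O → ∀ S → IsCut m col ρ τ S → CutColour m col ρ τ S (col τ) →
    ∀ x → inner s t S + x ≤ sumOver S (outdeg m col d O) → x + k ≤ boundary S
  cut-bound-α⁺ τ-white O balanced S (sρ , sτ) cut-colour x inner+x≤out = +-cancelˡ-≤ (inner s t S) _ _ (begin
    inner s t S + (x + k)                       ≡⟨ sym (+-assoc (inner s t S) x k) ⟩
    inner s t S + x + k                         ≤⟨ +-monoˡ-≤ k inner+x≤out ⟩
    sumOver S (outdeg m col d O) + k            ≡⟨ out+k≡αd ⟩
    sumOver S (αd m col d)                      ≤⟨ αd≤inner+boundary proper S (subst (BoundaryColour S) τ-white cut-colour) ⟩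
    inner s t S + boundary S                    ∎)
    where
    open ≤-Reasoning
    out+k≡αd : sumOver S (outdeg m col d O) + k ≡ sumOver S (αd m col d)
    out+k≡αd = trans
      (subst₂ (λ x y → sumOver S (outdeg m col d O) + [ x ]· k ≡ sumOver S (αd m col d) + [ y ]· k) sτ sρ
        (sumOver-transfer S k τ ρ _ _ balanced))
      (+-identityʳ _)

  α⁺-quasiAccessible⇒cornet : col τ ≡ white → ∀ O → FracOrientation m col d O × Balanced⁺ O →
    QuasiAccessible m col d ρ τ O → Cornet m col ρ τ
  α⁺-quasiAccessible⇒cornet τ-white O (frac , balanced) quasi = (tight , strictly) , τ-white
    where
    tight : Tight m col ρ τ
    tight S cut cut-colour = subst (_≤ boundary S) (sym weight-trivialCut)
      (cut-bound-α⁺ τ-white O balanced S cut cut-colour 0 (≤-trans (≤-reflexive (+-identityʳ _)) (inner≤outdeg O frac S)))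
    -- The forward path from a vertex v ≠ τ of S to ρ leaves S along a forward edge.
    strictly : ∀ S → IsCut m col ρ τ S → CutColour m col ρ τ S (col τ) → (∃ λ v → S v ≢ trivialCut m col ρ τ v) →
      weight m col ρ τ (trivialCut m col ρ τ) < weight m col ρ τ S
    strictly S cut@(sρ , sτ) cut-colour (v , Sv≢) with fpath-exits S O (quasi v v≢τ) Sv sρ
      where
      v≢τ : v ≢ τ
      v≢τ refl = Sv≢ (trans sτ (sym (⌊≟⌋-refl τ)))
      Sv : S v ≡ true
      Sv = Bool.¬-not (λ Sv≡false → Sv≢ (trans Sv≡false (sym (⌊≟⌋-≢ v≢τ))))
    ... | h , inside , outside , forward = subst (_< boundary S) (sym weight-trivialCut)
      (cut-bound-α⁺ τ-white O balanced S cut cut-colour 1 (inner<outdeg O frac S h inside outside forward))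

  tight⇒α⁺-orientation : 1 ≤ d → k ≤ d → Tight m col ρ τ → col τ ≡ white →
    ∃ λ O → FracOrientation m col d O × Balanced⁺ O
  tight⇒α⁺-orientation 1≤d k≤d tight τ-white =
    orientation-from-condition proper k τ ρ (τ≢ρ ∘ sym) (λ X → hakimi-condition 1≤d k≤d proper τ ρ X (white-cut X))
    where
    white-cut : ∀ X → X τ ≡ true → X ρ ≡ false → (∀ e → blackExits X e ≡ false) → k ≤ boundary X
    white-cut X xτ xρ no-black = subst (_≤ boundary X) weight-trivialCut
      (tight X (xρ , xτ) (subst (BoundaryColour X) (sym τ-white) (whiteBoundary X no-black)))

  -- A set S ∌ ρ containing τ whose only boundary edge leaves S at a black vertex u:
  -- removing u yields a white cut of weight at most deg u − 1 < k.
  module LoneBlackExit (tight : Tight m col ρ τ) (τ-white : col τ ≡ white) (deg≤d : ∀ v → deg m v ≤ d) (d≤k : d ≤ k)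
                       (S : Fin nV → Bool) (sρ : S ρ ≡ false) (sτ : S τ ≡ true)
                       (e₀ : Fin nE) (b₀ : Bool)
                       (inside : S (vert (e₀ , b₀)) ≡ true) (outside : S (vert (ι (e₀ , b₀))) ≡ false)
                       (u-black : col (vert (e₀ , b₀)) ≡ black)
                       (lone : ∀ e → e ≢ e₀ → crossing (S (s e)) (S (t e)) ≡ 0) where

    u : Fin nV
    u = vert (e₀ , b₀)

    S′ : Fin nV → Bool
    S′ w = S w ∧ not ⌊ w ≟ u ⌋

    τ≢u : τ ≢ u
    τ≢u τ≡u with trans (sym τ-white) (trans (cong col τ≡u) u-black)
    ... | ()

    S′-cut : IsCut m col ρ τ S′
    S′-cut = cong (_∧ not ⌊ ρ ≟ u ⌋) sρ , cong₂ (λ b c → b ∧ not c) sτ (⌊≟⌋-≢ τ≢u)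

    entry-at-u : ∀ h → S (vert h) ≡ false → S (vert (ι h)) ≡ true → vert (ι h) ≡ u
    entry-at-u (e , b) out in′ with e Fin.≟ e₀
    ... | no e≢e₀ = ⊥-elim (1≢0 (trans (sym (crossing-at b out in′)) (lone e e≢e₀)))
      where
      1≢0 : 1 ≢ 0
      1≢0 ()
      crossing-at : ∀ b → S (vert (e , b)) ≡ false → S (vert (ι (e , b))) ≡ true → crossing (S (s e)) (S (t e)) ≡ 1
      crossing-at true  out in′ rewrite out | in′ = refl
      crossing-at false out in′ rewrite out | in′ = refl
    ... | yes refl = same-edge b b₀ out in′ inside outside
      where
      same-edge : ∀ b b₀ → S (vert (e₀ , b)) ≡ false → S (vert (ι (e₀ , b))) ≡ true →
        S (vert (e₀ , b₀)) ≡ true → S (vert (ι (e₀ , b₀))) ≡ false → vert (ι (e₀ , b)) ≡ vert (e₀ , b₀)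
      same-edge true  true  out _ in′ _ = ⊥-elim (Bool.not-¬ in′ out)
      same-edge true  false _   _ _   _ = refl
      same-edge false true  _   _ _   _ = refl
      same-edge false false out _ in′ _ = ⊥-elim (Bool.not-¬ in′ out)

    S′-colour : CutColour m col ρ τ S′ (col τ)
    S′-colour h out in′ with S (vert h) in Sh
    ... | true  = begin
      col (vert (ι h))         ≡⟨ ≢⇒opposite (proper h) ⟩
      opposite (col (vert h))  ≡⟨ cong (opposite ∘ col) (⌊≟⌋-sound (Bool.not-injective out)) ⟩
      opposite (col u)         ≡⟨ cong opposite u-black ⟩
      white                    ≡⟨ sym τ-white ⟩
      col τ                    ∎
      where open ≡-Reasoning
    ... | false = ⊥-elim (Bool.not-¬ (subst (λ w → not ⌊ w ≟ u ⌋ ≡ true) at-u (Bool.∧-conicalʳ _ _ in′)) (cong not (⌊≟⌋-refl u)))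
      where
      at-u : vert (ι h) ≡ u
      at-u = entry-at-u h Sh (Bool.∧-conicalˡ _ _ in′)

    boundary-S′ : boundary S′ + 1 ≤ deg m u
    boundary-S′ = sumFin-mono-≤-at nE 1 e₀ per-edge (at-e₀ b₀ inside outside)
      where
      at-e₀ : ∀ b → S (vert (e₀ , b)) ≡ true → S (vert (ι (e₀ , b))) ≡ false →
        crossing (S (s e₀) ∧ not ⌊ s e₀ ≟ vert (e₀ , b) ⌋) (S (t e₀) ∧ not ⌊ t e₀ ≟ vert (e₀ , b) ⌋) + 1
          ≤ [ ⌊ s e₀ ≟ vert (e₀ , b) ⌋ ]· 1 + [ ⌊ t e₀ ≟ vert (e₀ , b) ⌋ ]· 1
      at-e₀ true  in′ out rewrite in′ | out | ⌊≟⌋-refl (s e₀) = s≤s z≤n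
      at-e₀ false in′ out rewrite in′ | out | ⌊≟⌋-refl (t e₀) = m≤n+m 1 _
      per-edge : ∀ e → crossing (S′ (s e)) (S′ (t e)) ≤ [ ⌊ s e ≟ u ⌋ ]· 1 + [ ⌊ t e ≟ u ⌋ ]· 1
      per-edge e with e Fin.≟ e₀
      ... | yes refl  = m+n≤o⇒m≤o _ (at-e₀ b₀ inside outside)
      ... | no e≢e₀ = crossing-removed (S (s e)) (S (t e)) ⌊ s e ≟ u ⌋ ⌊ t e ≟ u ⌋ (lone e e≢e₀)

    impossible : ⊥
    impossible = <-irrefl refl (begin-strict
      k                 ≤⟨ subst (_≤ boundary S′) weight-trivialCut (tight S′ S′-cut S′-colour) ⟩
      boundary S′       <⟨ m<m+n _ (s≤s z≤n) ⟩
      boundary S′ + 1   ≤⟨ boundary-S′ ⟩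
      deg m u           ≤⟨ deg≤d u ⟩
      d                 ≤⟨ d≤k ⟩
      k                 ∎)
      where open ≤-Reasoning

  cornet⇒no-light-set : 1 ≤ d → k ≤ d → Connected m → (∀ v → deg m v ≤ d) → Cornet m col ρ τ →
    ∀ S → S ρ ≡ false → ∀ v → v ≢ τ → S v ≡ true → ¬ (sumOver S (αd m col d) ≤ inner s t S + [ S τ ]· k)
  cornet⇒no-light-set 1≤d k≤d connected deg≤d ((tight , strict) , τ-white) S sρ v v≢τ sv light
    with Fin.any? (λ e → blackExits S e Bool.≟ true)
  ... | no no-black = by-τ (S τ) refl
    where
    boundary≤[τ∈S]k : boundary S ≤ [ S τ ]· k
    boundary≤[τ∈S]k = +-cancelˡ-≤ (inner s t S) _ _ (≤-trans (inner+boundary≤αd 1≤d proper S) light)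
    by-τ : ∀ b → S τ ≡ b → ⊥
    by-τ false sτ = <-irrefl refl (≤-trans (connected⇒1≤boundary connected S sv sρ)
      (≤-trans boundary≤[τ∈S]k (≤-reflexive (cong ([_]· k) sτ))))
    by-τ true  sτ = <-irrefl refl (≤-trans
      (subst (_< boundary S) weight-trivialCut (strict S (sρ , sτ)
        (subst (BoundaryColour S) (sym τ-white) (whiteBoundary S (λ e → Bool.¬-not (λ black → no-black (e , black)))))
        (v , λ Sv≡ → Bool.not-¬ sv (trans Sv≡ (⌊≟⌋-≢ v≢τ)))))
      (≤-trans boundary≤[τ∈S]k (≤-reflexive (cong ([_]· k) sτ))))
  ... | yes (e₀ , black-exit) with blackExit-halfEdge S e₀ black-exit
  ...   | b₀ , inside , outside , u-black =
    LoneBlackExit.impossible tight τ-white deg≤d d≤k S sρ sτ e₀ b₀ inside outside u-black lone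
    where
    bound : boundary S + (d ∸ 1) ≤ [ S τ ]· k
    bound = +-cancelˡ-≤ (inner s t S) _ _ (begin
      inner s t S + (boundary S + (d ∸ 1))   ≡⟨ sym (+-assoc (inner s t S) _ _) ⟩
      inner s t S + boundary S + (d ∸ 1)     ≤⟨ inner+boundary+[d∸1]≤αd 1≤d proper S e₀ black-exit ⟩
      sumOver S (αd m col d)                 ≤⟨ light ⟩
      inner s t S + [ S τ ]· k               ∎)
      where open ≤-Reasoning
    d≤[τ∈S]k : d ≤ [ S τ ]· k
    d≤[τ∈S]k = begin
      d                       ≡⟨ sym (m+[n∸m]≡n 1≤d) ⟩
      1 + (d ∸ 1)             ≤⟨ +-monoˡ-≤ (d ∸ 1) (blackExit⇒1≤boundary S e₀ black-exit) ⟩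
      boundary S + (d ∸ 1)    ≤⟨ bound ⟩
      [ S τ ]· k              ∎
      where open ≤-Reasoning
    sτ : S τ ≡ true
    sτ = Bool.¬-not (λ sτ≡false → <-irrefl refl (≤-trans 1≤d (≤-trans d≤[τ∈S]k (≤-reflexive (cong ([_]· k) sτ≡false)))))
    d≤k : d ≤ k
    d≤k = ≤-trans d≤[τ∈S]k ([]·-≤ (S τ) k)
    boundary≤1 : boundary S ≤ 1
    boundary≤1 = +-cancelʳ-≤ (d ∸ 1) (boundary S) 1
      (≤-trans bound (≤-trans ([]·-≤ (S τ) k) (≤-trans k≤d (≤-reflexive (sym (m+[n∸m]≡n 1≤d))))))
    lone : ∀ e → e ≢ e₀ → crossing (S (s e)) (S (t e)) ≡ 0
    lone e e≢e₀ = n≤0⇒n≡0 (+-cancelʳ-≤ 1 _ 0 (begin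
      crossing (S (s e)) (S (t e)) + 1                             ≤⟨ +-monoʳ-≤ _ (blackExit⇒1≤crossing (S (s e₀)) (S (t e₀)) (col (s e₀)) (col (t e₀)) black-exit) ⟩
      crossing (S (s e)) (S (t e)) + crossing (S (s e₀)) (S (t e₀)) ≤⟨ two-terms≤sumFin nE _ e e₀ e≢e₀ ⟩
      boundary S                                                   ≤⟨ boundary≤1 ⟩
      1                                                            ∎))
      where open ≤-Reasoning

  cornet⇒α⁺-quasiAccessible : 1 ≤ d → k ≤ d → Connected m → (∀ v → deg m v ≤ d) → Cornet m col ρ τ →
    ∀ O → FracOrientation m col d O → Balanced⁺ O → QuasiAccessible m col d ρ τ O
  cornet⇒α⁺-quasiAccessible 1≤d k≤d connected deg≤d cornet O frac balanced v v≢τ with Reachability.closure O ρ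
  ... | A , reaches , aρ , closed with A v in av
  ...   | true  = reaches v av
  ...   | false = ⊥-elim (cornet⇒no-light-set 1≤d k≤d connected deg≤d cornet S (cong not aρ) v v≢τ (cong not av) light)
    where
    S : Fin nV → Bool
    S = not ∘ A
    light : sumOver S (αd m col d) ≤ inner s t S + [ S τ ]· k
    light = begin
      sumOver S (αd m col d)                      ≡⟨ sym (+-identityʳ _) ⟩
      sumOver S (αd m col d) + 0                  ≡⟨ cong (λ b → sumOver S (αd m col d) + [ b ]· k) (sym (cong not aρ)) ⟩
      sumOver S (αd m col d) + [ S ρ ]· k         ≡⟨ sym (sumOver-transfer S k τ ρ _ _ balanced) ⟩
      sumOver S (outdeg m col d O) + [ S τ ]· k   ≤⟨ +-monoˡ-≤ _ (outdeg≤inner O frac S (Reachability.noForwardEntry⇒noForwardExit O ρ A closed)) ⟩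
      inner s t S + [ S τ ]· k                    ∎
      where open ≤-Reasoning

  cornet⇒quasiAccessible-α⁺-orientation : 1 ≤ d → k ≤ d → Connected m → (∀ v → deg m v ≤ d) → Cornet m col ρ τ →
    ∃ λ O → IsOrientation m col d (α⁺ m col d k ρ τ) O × QuasiAccessible m col d ρ τ O
  cornet⇒quasiAccessible-α⁺-orientation 1≤d k≤d connected deg≤d cornet@((tight , _) , τ-white)
    with tight⇒α⁺-orientation 1≤d k≤d tight τ-white
  ... | O , frac , balanced =
    O , Equivalence.from (α⁺-orientation⇔ O) (frac , balanced) , cornet⇒α⁺-quasiAccessible 1≤d k≤d connected deg≤d cornet O frac balanced

lemma2p19 : (d k : ℕ) → 1 ≤ k → k ≤ d →
    (m : Map) → Planar m →
    (col : Vertex m → Colour) → ProperColouring m col →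
    (ρ τ : Vertex m) → τ ≢ ρ →
    (∀ v → deg m v ≤ d) → deg m τ ≡ k →
    ((col τ ≡ black →
        (Trumpet m col ρ τ ⇔ Feasible m col d (α⁻ m col d k ρ τ))
        × (∀ O → IsOrientation m col d (α⁻ m col d k ρ τ) O → Accessible m col d ρ O))
    × (col τ ≡ white →
        (Cornet m col ρ τ ⇔
          (∃ λ O → IsOrientation m col d (α⁺ m col d k ρ τ) O × QuasiAccessible m col d ρ τ O))))
lemma2p19 d k 1≤k k≤d m (connected , _) col proper ρ τ τ≢ρ deg≤d deg-τ =
  (λ τ-black →
    mk⇔ (λ (tight , _) → tight⇒α⁻-feasible 1≤d k≤d tight τ-black)
        (λ (O , isO) → α⁻-orientation⇒tight O (as-balanced⁻ O isO) τ-black , τ-black)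
    , λ O isO → α⁻-orientation⇒accessible 1≤d connected O (as-balanced⁻ O isO))
  ,
  (λ τ-white →
    mk⇔ (cornet⇒quasiAccessible-α⁺-orientation 1≤d k≤d connected deg≤d)
        (λ (O , isO , quasi) → α⁺-quasiAccessible⇒cornet τ-white O (as-balanced⁺ O isO) quasi))
  where
  open TrumpetsAndCornets m col proper d k ρ τ τ≢ρ deg-τ
  open Demands m col d k ρ τ
  1≤d : 1 ≤ d
  1≤d = ≤-trans 1≤k k≤d
  as-balanced⁻ : ∀ O → IsOrientation m col d (α⁻ m col d k ρ τ) O → FracOrientation m col d O × Balanced⁻ O
  as-balanced⁻ O = Equivalence.to (α⁻-orientation⇔ O)
  as-balanced⁺ : ∀ O → IsOrientation m col d (α⁺ m col d k ρ τ) O → FracOrientation m col d O × Balanced⁺ O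
  as-balanced⁺ O = Equivalence.to (α⁺-orientation⇔ O)
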